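{- Let $n,k$ be integers with $2 \leq k \leq n-2$. The sparse paving positroids on the ground set $[n]$ of rank $k$ are in bijection with the non-adjacent subsets of $[n]$.
   Context: A positroid of rank $k$ on $[n]$ is the matroid whose bases are $\bigcap_{t=1}^n\{J\in\binom{[n]}{k}: I_t\le_t J\}$ for a Grassmann necklace $(I_1,\dots,I_n)$ of $k$-subsets; here $<_t$ is the order $t<_t t+1<_t\cdots<_t n<_t 1<_t\cdots<_t t-1$ on $[n]$, and $I\le_t J$ for $k$-subsets means the $m$-th smallest element of $I$ is $\le_t$ the $m$-th smallest element of $J$ (w.r.t. $<_t$) for each $m$. A Grassmann necklace is a sequence $(I_1,\dots,I_n)$ of subsets of $[n]$ (indices mod $n$) with: if $i\in I_i$ then $I_{i+1}=(I_i\setminus\{i\})\cup\{j\}$ for some $j$, and if $i\notin I_i$ then $I_{i+1}=I_i$. A rank-$k$ matroid is sparse paving if it and its dual have all circuits of size at least their respective ranks. A set $A\subseteq[n]$ is non-adjacent if whenever $i\in A$, neither $i-1$ nor $i+1$ is in $A$, with indices considered modulo $n$. -}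

module Defs where

open import Data.Nat using (ℕ; zero; suc; _+_; _∸_; _≤_; _<ᵇ_)
open import Data.Nat.Properties using (_<?_)
open import Data.Bool using (Bool; true; false; if_then_else_)
open import Data.Fin using (Fin; zero; suc; toℕ; fromℕ<; fromℕ; inject₁)
open import Data.Fin.Subset using (Subset; _∈_; _∉_; _⊆_; _⊂_; ∁; _∪_; _-_; ⁅_⁆; ∣_∣)
open import Data.Vec using (Vec; []; _∷_)
open import Data.List using (List; []; _∷_; concatMap; upTo)
open import Data.List.Relation.Binary.Pointwise using (Pointwise)
open import Data.Product using (Σ; ∃; _×_; proj₁)
open import Relation.Nullary using (¬_; yes; no)
open import Relation.Binary.PropositionalEquality using (_≡_)
open import Function.Bundles using (_⇔_)

-- Ground set [n] is modelled as Fin n = {0,…,n-1} (i ↦ i+1 relabelling).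

csuc : ∀ {n} → Fin n → Fin n
csuc {suc m} i with toℕ i <? m
... | yes p = suc (fromℕ< p)
... | no _  = zero

cpred : ∀ {n} → Fin n → Fin n
cpred {suc m} zero    = fromℕ m
cpred {suc m} (suc i) = inject₁ i

-- membership test for natural-number indices (false outside the range)
memℕ : ∀ {n} → Subset n → ℕ → Bool
memℕ []       _       = false
memℕ (b ∷ bs) zero    = b
memℕ (b ∷ bs) (suc x) = memℕ bs x

-- x mod n, for x < 2n
wrap : ℕ → ℕ → ℕ
wrap n x = if x <ᵇ n then x else x ∸ n

-- The elements of I listed in increasing <_t order, each element i recorded
-- by its position (i - t) mod n in the order t <_t t+1 <_t … <_t t-1.
-- Comparing positions is exactly comparing elements with respect to ≤_t.
tRanks : ∀ {n} → Fin n → Subset n → List ℕ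
tRanks {n} t I =
  concatMap (λ r → if memℕ I (wrap n (toℕ t + r)) then r ∷ [] else []) (upTo n)

GaleLe : ∀ {n} → Fin n → Subset n → Subset n → Set
GaleLe t I J = Pointwise _≤_ (tRanks t I) (tRanks t J)

IsGrassmannNecklace : (n k : ℕ) → (Fin n → Subset n) → Set
IsGrassmannNecklace n k I =
  (∀ i → ∣ I i ∣ ≡ k) ×
  (∀ i → (i ∈ I i → ∃ λ j → I (csuc i) ≡ (I i - i) ∪ ⁅ j ⁆) ×
         (i ∉ I i → I (csuc i) ≡ I i))

Family : ℕ → Set
Family n = Subset n → Bool

IsPositroid : (n k : ℕ) → Family n → Set
IsPositroid n k B =
  Σ (Fin n → Subset n) λ I → IsGrassmannNecklace n k I ×
    (∀ J → (B J ≡ true) ⇔ ((∣ J ∣ ≡ k) × (∀ t → GaleLe t (I t) J)))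

Independent : ∀ {n} → Family n → Subset n → Set
Independent B X = ∃ λ Y → (B Y ≡ true) × (X ⊆ Y)

IsCircuit : ∀ {n} → Family n → Subset n → Set
IsCircuit B C = ¬ Independent B C × (∀ D → D ⊂ C → Independent B D)

dual : ∀ {n} → Family n → Family n
dual B X = B (∁ X)

IsSparsePaving : (n k : ℕ) → Family n → Set
IsSparsePaving n k B =
  (∀ C → IsCircuit B C → k ≤ ∣ C ∣) ×
  (∀ C → IsCircuit (dual B) C → n ∸ k ≤ ∣ C ∣)

SparsePavingPositroid : (n k : ℕ) → Set
SparsePavingPositroid n k = Σ (Family n) λ B → IsPositroid n k B × IsSparsePaving n k B

IsNonAdjacent : ∀ {n} → Subset n → Set
IsNonAdjacent A = ∀ i → i ∈ A → (cpred i ∉ A) × (csuc i ∉ A)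

NonAdjacentSubset : ℕ → Set
NonAdjacentSubset n = Σ (Subset n) IsNonAdjacent

_≈F_ : ∀ {n} → Family n → Family n → Set
B ≈F B' = ∀ J → B J ≡ B' J

-- For a non-adjacent A take I_t = [t, t+k-1] when t ∉ A and I_t = [t, t+k-2] ∪ {t+k} when t ∈ A.
-- This is a Grassmann necklace, and a k-set J satisfies I_t ≤_t J for the gapped I_t exactly
-- when J ≠ [t, t+k-1]: the positroid is the uniform matroid U(k, n) with the intervals starting
-- in A removed from its bases, and A is recovered as the set of starts of non-basis intervals.
-- It is sparse paving because a set C of size < k always has a basis above it: if the k-interval
-- [t, t+k-1] ⊇ C starts in A, drop a point x ∉ C from it and add t+k; the result is either not an
-- interval or, when x = t, the interval starting at t+1 ∉ A. The dual follows by complementation.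
-- Conversely, in a sparse paving positroid each I_t lies Gale-below a basis containing
-- [t, t+k-2] and a basis inside [t, t+k]; only the two shapes above survive, and the necklace
-- rule forbids gapped I_t and I_(t+1), so the gapped positions form a non-adjacent set.

module Submission where

open import Defs
open import Data.Bool using (Bool; true; false; not; _∧_; _∨_; if_then_else_)
open import Data.Bool.Properties using (T-≡; ∨-assoc; ∨-comm; ∧-identityʳ; ∧-zeroʳ; not-involutive)
  renaming (_≟_ to _≟ᵇ_)
open import Data.Empty using (⊥; ⊥-elim)
open import Data.Fin using (Fin; zero; suc; toℕ; fromℕ<)
open import Data.Fin.Properties using (any?; toℕ<n; toℕ-fromℕ<; toℕ-fromℕ; toℕ-inject₁; toℕ-injective; all?)
open import Data.Fin.Subset using (Subset; _∈_; _∉_; _⊆_; _⊂_; ∁; _∪_; _-_; _─_; ⁅_⁆; ∣_∣)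
  renaming (⊥ to ∅)
open import Data.Fin.Subset.Properties
  using (⊆-antisym; _∈?_; _⊆?_; anySubset?; s⊆s; out⊆; ∣p∣≤n; p⊆q⇒∣p∣≤∣q∣; p⊂q⇒∣p∣<∣q∣; ∣∁p∣≡n∸∣p∣)
open import Data.List using (List; []; _∷_; _++_; [_]; length; concatMap; applyUpTo)
open import Data.List.Properties using (length-++; ++-identityʳ)
open import Data.List.Membership.Propositional using () renaming (_∈_ to _∈ₗ_)
open import Data.List.Relation.Unary.Any using (here; there)
open import Data.List.Relation.Binary.Pointwise using (Pointwise; []; _∷_)
open import Data.List.Relation.Binary.Pointwise.Properties using (decidable)
open import Data.Nat
open import Data.Nat.DivMod
open import Data.Nat.Properties
open import Data.Product using (Σ; ∃; _×_; _,_; proj₁; proj₂)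
open import Data.Sum using (_⊎_; inj₁; inj₂)
open import Data.Vec using ([]; _∷_; here; there; tabulate)
open import Function using (_∘_)
open import Function.Bundles using (_⇔_; mk⇔; Equivalence)
open import Relation.Binary.PropositionalEquality hiding ([_])
open import Relation.Nullary using (¬_; yes; no; Dec)
open import Relation.Nullary.Decidable using (_×-dec_; ¬?; isYes; toWitness; fromWitness)

open Equivalence using (to; from)

true≢false : true ≢ false
true≢false ()

<ᵇ-true : ∀ {x k} → x < k → (x <ᵇ k) ≡ true
<ᵇ-true p = to T-≡ (<⇒<ᵇ p)

<ᵇ-true⁻ : ∀ {x k} → (x <ᵇ k) ≡ true → x < k
<ᵇ-true⁻ {x} {k} e = <ᵇ⇒< x k (from T-≡ e)

<ᵇ-false : ∀ {x k} → k ≤ x → (x <ᵇ k) ≡ false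
<ᵇ-false {x} {k} p with x <ᵇ k in e
... | false = refl
... | true  = ⊥-elim (<⇒≱ (<ᵇ-true⁻ e) p)

<ᵇ-false⁻ : ∀ {x k} → (x <ᵇ k) ≡ false → k ≤ x
<ᵇ-false⁻ {x} {k} e with x <? k
... | yes p = ⊥-elim (true≢false (trans (sym (<ᵇ-true p)) e))
... | no p  = ≮⇒≥ p

≡ᵇ-true : ∀ {x y} → x ≡ y → (x ≡ᵇ y) ≡ true
≡ᵇ-true {x} {y} p = to T-≡ (≡⇒≡ᵇ x y p)

≡ᵇ-true⁻ : ∀ {x y} → (x ≡ᵇ y) ≡ true → x ≡ y
≡ᵇ-true⁻ {x} {y} e = ≡ᵇ⇒≡ x y (from T-≡ e)

≡ᵇ-false : ∀ {x y} → x ≢ y → (x ≡ᵇ y) ≡ false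
≡ᵇ-false {x} {y} p with x ≡ᵇ y in e
... | false = refl
... | true  = ⊥-elim (p (≡ᵇ-true⁻ e))

≡-Bool : ∀ {a b : Bool} → (a ≡ true → b ≡ true) → (b ≡ true → a ≡ true) → a ≡ b
≡-Bool {true}  {true}  f g = refl
≡-Bool {false} {false} f g = refl
≡-Bool {true}  {false} f g = sym (f refl)
≡-Bool {false} {true}  f g = g refl

≡-not : ∀ {a b : Bool} → (a ≡ true → b ≢ true) → (a ≡ false → b ≡ true) → a ≡ not b
≡-not {true}  {true}  f g = ⊥-elim (f refl refl)
≡-not {true}  {false} f g = refl
≡-not {false} {true}  f g = refl
≡-not {false} {false} f g = ⊥-elim (true≢false (sym (g refl)))

<ᵇ-suc : ∀ q j → (q <ᵇ suc j) ≡ ((q <ᵇ j) ∨ (q ≡ᵇ j))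
<ᵇ-suc zero    zero    = refl
<ᵇ-suc zero    (suc j) = refl
<ᵇ-suc (suc q) zero    = refl
<ᵇ-suc (suc q) (suc j) = <ᵇ-suc q j

[m%n+o]%n≡[m+o]%n : ∀ m o n .{{_ : NonZero n}} → (m % n + o) % n ≡ (m + o) % n
[m%n+o]%n≡[m+o]%n m o n = begin
  (m % n + o) % n           ≡⟨ %-distribˡ-+ (m % n) o n ⟩
  (m % n % n + o % n) % n   ≡⟨ cong (λ z → (z + o % n) % n) (m%n%n≡m%n m n) ⟩
  (m % n + o % n) % n       ≡⟨ %-distribˡ-+ m o n ⟨
  (m + o) % n               ∎
  where open ≡-Reasoning

[m+o%n]%n≡[m+o]%n : ∀ m o n .{{_ : NonZero n}} → (m + o % n) % n ≡ (m + o) % n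
[m+o%n]%n≡[m+o]%n m o n = begin
  (m + o % n) % n ≡⟨ cong (_% n) (+-comm m (o % n)) ⟩
  (o % n + m) % n ≡⟨ [m%n+o]%n≡[m+o]%n o m n ⟩
  (o + m) % n     ≡⟨ cong (_% n) (+-comm o m) ⟩
  (m + o) % n     ∎
  where open ≡-Reasoning

m<n⇒[m+n]%n≡m : ∀ {m n} .{{_ : NonZero n}} → m < n → (m + n) % n ≡ m
m<n⇒[m+n]%n≡m {m} {n} p = trans ([m+n]%n≡m%n m n) (m<n⇒m%n≡m p)

module Cyclic (n : ℕ) {{_ : NonZero n}} where

  infixl 6 _⊕_

  _⊕_ : ℕ → ℕ → ℕ
  t ⊕ r = (t + r) % n

  offset : ℕ → ℕ → ℕ
  offset t y = (y + (n ∸ t)) % n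

  ⊕<n : ∀ t r → t ⊕ r < n
  ⊕<n t r = m%n<n (t + r) n

  offset<n : ∀ t y → offset t y < n
  offset<n t y = m%n<n (y + (n ∸ t)) n

  ⊕-offset : ∀ {t y} → t ≤ n → y < n → t ⊕ offset t y ≡ y
  ⊕-offset {t} {y} t≤n y<n = begin
    (t + (y + (n ∸ t)) % n) % n ≡⟨ [m+o%n]%n≡[m+o]%n t (y + (n ∸ t)) n ⟩
    (t + (y + (n ∸ t))) % n     ≡⟨ cong (_% n) (+-comm t _) ⟩
    ((y + (n ∸ t)) + t) % n     ≡⟨ cong (_% n) (+-assoc y (n ∸ t) t) ⟩
    (y + ((n ∸ t) + t)) % n     ≡⟨ cong (λ z → (y + z) % n) (m∸n+n≡m t≤n) ⟩
    (y + n) % n                 ≡⟨ m<n⇒[m+n]%n≡m y<n ⟩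
    y                           ∎
    where open ≡-Reasoning

  offset-⊕ˡ : ∀ t a d → offset t (a ⊕ d) ≡ (offset t a + d) % n
  offset-⊕ˡ t a d = begin
    ((a + d) % n + (n ∸ t)) % n ≡⟨ [m%n+o]%n≡[m+o]%n (a + d) (n ∸ t) n ⟩
    (a + d + (n ∸ t)) % n       ≡⟨ cong (_% n) (+-assoc a d (n ∸ t)) ⟩
    (a + (d + (n ∸ t))) % n     ≡⟨ cong (λ z → (a + z) % n) (+-comm d (n ∸ t)) ⟩
    (a + ((n ∸ t) + d)) % n     ≡⟨ cong (_% n) (+-assoc a (n ∸ t) d) ⟨
    (a + (n ∸ t) + d) % n       ≡⟨ [m%n+o]%n≡[m+o]%n (a + (n ∸ t)) d n ⟨
    ((a + (n ∸ t)) % n + d) % n ∎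
    where open ≡-Reasoning

  offset-self : ∀ {t} → t ≤ n → offset t t ≡ 0
  offset-self t≤n = trans (cong (_% n) (m+[n∸m]≡n t≤n)) (n%n≡0 n)

  offset-⊕ : ∀ {t r} → t ≤ n → r < n → offset t (t ⊕ r) ≡ r
  offset-⊕ {t} {r} t≤n r<n = begin
    offset t (t ⊕ r)        ≡⟨ offset-⊕ˡ t t r ⟩
    (offset t t + r) % n    ≡⟨ cong (λ z → (z + r) % n) (offset-self t≤n) ⟩
    r % n                   ≡⟨ m<n⇒m%n≡m r<n ⟩
    r                       ∎
    where open ≡-Reasoning

  ⊕-identityʳ : ∀ {t} → t < n → t ⊕ 0 ≡ t
  ⊕-identityʳ {t} t<n = trans (cong (_% n) (+-identityʳ t)) (m<n⇒m%n≡m t<n)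

  offset-injective : ∀ {t y z} → t ≤ n → y < n → z < n → offset t y ≡ offset t z → y ≡ z
  offset-injective {t} {y} {z} t≤n y<n z<n e =
    trans (sym (⊕-offset t≤n y<n)) (trans (cong (t ⊕_) e) (⊕-offset t≤n z<n))

  offset≡0⇒≡ : ∀ {t y} → t < n → y < n → offset t y ≡ 0 → y ≡ t
  offset≡0⇒≡ t<n y<n e = offset-injective (<⇒≤ t<n) y<n t<n (trans e (sym (offset-self (<⇒≤ t<n))))

  offset-suc : ∀ t y → offset t (y ⊕ 1) ≡ suc (offset t y) % n
  offset-suc t y = trans (offset-⊕ˡ t y 1) (cong (_% n) (+-comm (offset t y) 1))

  offset-suc-< : ∀ t y → suc (offset t y) < n → offset t (y ⊕ 1) ≡ suc (offset t y)
  offset-suc-< t y p = trans (offset-suc t y) (m<n⇒m%n≡m p)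

  offset-suc-≡n : ∀ t y → suc (offset t y) ≡ n → offset t (y ⊕ 1) ≡ 0
  offset-suc-≡n t y p = trans (offset-suc t y) (trans (cong (_% n) p) (n%n≡0 n))

  ⊕-suc : ∀ t p → (t ⊕ 1) ⊕ p ≡ t ⊕ suc p
  ⊕-suc t p = trans ([m%n+o]%n≡[m+o]%n (t + 1) p n) (cong (_% n) (+-assoc t 1 p))

  ⊕-comm-suc : ∀ t c → (t ⊕ 1) ⊕ c ≡ (t ⊕ c) ⊕ 1
  ⊕-comm-suc t c = trans (⊕-suc t c) (trans (cong (λ z → (t + z) % n) (+-comm 1 c))
    (trans (cong (_% n) (sym (+-assoc t c 1))) (sym ([m%n+o]%n≡[m+o]%n (t + c) 1 n))))

  offset-⊕-suc : ∀ {t} p → t ≤ n → offset t ((t ⊕ 1) ⊕ p) ≡ suc p % n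
  offset-⊕-suc {t} p t≤n = trans (cong (offset t) (⊕-suc t p))
    (trans (offset-⊕ˡ t t (suc p)) (cong (λ z → (z + suc p) % n) (offset-self t≤n)))

  ⊕-⊕-complement : ∀ {t c} → t < n → c ≤ n → (t ⊕ c) ⊕ (n ∸ c) ≡ t
  ⊕-⊕-complement {t} {c} t<n c≤n = trans ([m%n+o]%n≡[m+o]%n (t + c) (n ∸ c) n)
    (trans (cong (_% n) (trans (+-assoc t c (n ∸ c)) (cong (t +_) (m+[n∸m]≡n c≤n)))) (m<n⇒[m+n]%n≡m t<n))

  offset-via : ∀ {t y c} → t < n → y < n → c < n → offset t y ≡ (c + offset (t ⊕ c) y) % n
  offset-via {t} {y} {c} t<n y<n c<n =
    trans (cong (offset t) (sym (⊕-offset (<⇒≤ (⊕<n t c)) y<n)))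
      (trans (offset-⊕ˡ t (t ⊕ c) (offset (t ⊕ c) y))
        (cong (λ z → (z + offset (t ⊕ c) y) % n) (offset-⊕ (<⇒≤ t<n) c<n)))

  ≡ᵇ-⊕ : ∀ {t y c} → t < n → y < n → c < n → (y ≡ᵇ t ⊕ c) ≡ (offset t y ≡ᵇ c)
  ≡ᵇ-⊕ {t} {y} {c} t<n y<n c<n = ≡-Bool
    (λ e → ≡ᵇ-true (trans (cong (offset t) (≡ᵇ-true⁻ e)) (offset-⊕ (<⇒≤ t<n) c<n)))
    (λ e → ≡ᵇ-true (trans (sym (⊕-offset (<⇒≤ t<n) y<n)) (cong (t ⊕_) (≡ᵇ-true⁻ e))))

InRange : ℕ → ℕ → ℕ → Set
InRange a b x = a ≤ x × x < a + b

InRange-head : ∀ a b → InRange a (suc b) a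
InRange-head a b = ≤-refl , subst (a <_) (sym (+-suc a b)) (s≤s (m≤m+n a b))

InRange-tail : ∀ {a b x} → InRange (suc a) b x → InRange a (suc b) x
InRange-tail {a} {b} {x} (p , q) = <⇒≤ p , subst (x <_) (sym (+-suc a b)) q

InRange-step : ∀ {a b x} → InRange a (suc b) x → a ≢ x → InRange (suc a) b x
InRange-step {a} {b} {x} (p , q) a≢x = ≤∧≢⇒< p a≢x , subst (x <_) (+-suc a b) q

InRange-empty : ∀ {a x} → ¬ InRange a 0 x
InRange-empty {a} {x} (p , q) = <⇒≱ q (subst (_≤ x) (sym (+-identityʳ a)) p)

range : ℕ → ℕ → List ℕ
range a zero    = []
range a (suc b) = a ∷ range (suc a) b

length-range : ∀ a b → length (range a b) ≡ b
length-range a zero    = refl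
length-range a (suc b) = cong suc (length-range (suc a) b)

range-suc : ∀ a b → range a (suc b) ≡ range a b ++ [ a + b ]
range-suc a zero    = cong (λ z → z ∷ []) (sym (+-identityʳ a))
range-suc a (suc b) =
  cong (a ∷_) (trans (range-suc (suc a) b) (cong (λ z → range (suc a) b ++ [ z ]) (sym (+-suc a b))))

select : (ℕ → Bool) → ℕ → ℕ → List ℕ
select h a zero    = []
select h a (suc b) = if h a then a ∷ select h (suc a) b else select h (suc a) b

count : (ℕ → Bool) → ℕ → ℕ → ℕ
count h a b = length (select h a b)

data Ascending : ℕ → List ℕ → Set where
  []  : ∀ {a} → Ascending a []
  _∷_ : ∀ {a x xs} → a ≤ x → Ascending (suc x) xs → Ascending a (x ∷ xs)

Ascending-weaken : ∀ {a b xs} → a ≤ b → Ascending b xs → Ascending a xs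
Ascending-weaken p []       = []
Ascending-weaken p (q ∷ qs) = ≤-trans p q ∷ qs

Ascending-∈ : ∀ {a x xs} → Ascending a xs → x ∈ₗ xs → a ≤ x
Ascending-∈ (q ∷ qs) (here refl) = q
Ascending-∈ (q ∷ qs) (there m)   = <⇒≤ (≤-trans (s≤s q) (Ascending-∈ qs m))

select-Ascending : ∀ h a b → Ascending a (select h a b)
select-Ascending h a zero = []
select-Ascending h a (suc b) with h a
... | true  = ≤-refl ∷ select-Ascending h (suc a) b
... | false = Ascending-weaken (n≤1+n a) (select-Ascending h (suc a) b)

∈-select⁻ : ∀ h a b {x} → x ∈ₗ select h a b → InRange a b x × h x ≡ true
∈-select⁻ h a (suc b) {x} m with h a in e
∈-select⁻ h a (suc b) (here refl) | true = InRange-head a b , e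
∈-select⁻ h a (suc b) (there m)   | true =
  let (r , hx) = ∈-select⁻ h (suc a) b m in InRange-tail r , hx
∈-select⁻ h a (suc b) m | false =
  let (r , hx) = ∈-select⁻ h (suc a) b m in InRange-tail r , hx

∈-select⁺ : ∀ h a b {x} → InRange a b x → h x ≡ true → x ∈ₗ select h a b
∈-select⁺ h a zero    r hx = ⊥-elim (InRange-empty r)
∈-select⁺ h a (suc b) {x} r hx with a ≟ x
... | yes refl rewrite hx = here refl
... | no a≢x with h a
...   | true  = there (∈-select⁺ h (suc a) b (InRange-step r a≢x) hx)
...   | false = ∈-select⁺ h (suc a) b (InRange-step r a≢x) hx

select-cong : ∀ {h h'} a b → (∀ x → InRange a b x → h x ≡ h' x) → select h a b ≡ select h' a b
select-cong a zero e = refl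
select-cong {h} {h'} a (suc b) e rewrite e a (InRange-head a b)
  = cong (λ xs → if h' a then a ∷ xs else xs) (select-cong (suc a) b (λ x r → e x (InRange-tail r)))

select-++ : ∀ h a b c → select h a (b + c) ≡ select h a b ++ select h (a + b) c
select-++ h a zero c rewrite +-identityʳ a = refl
select-++ h a (suc b) c rewrite +-suc a b with h a
... | true  = cong (a ∷_) (select-++ h (suc a) b c)
... | false = select-++ h (suc a) b c

select-none : ∀ h a b → (∀ x → InRange a b x → h x ≡ false) → select h a b ≡ []
select-none h a zero e = refl
select-none h a (suc b) e rewrite e a (InRange-head a b) = select-none h (suc a) b (λ x r → e x (InRange-tail r))

select-all : ∀ h a b → (∀ x → InRange a b x → h x ≡ true) → select h a b ≡ range a b
select-all h a zero e = refl
select-all h a (suc b) e rewrite e a (InRange-head a b) =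
  cong (a ∷_) (select-all h (suc a) b (λ x r → e x (InRange-tail r)))

count-++ : ∀ h a b c → count h a (b + c) ≡ count h a b + count h (a + b) c
count-++ h a b c = trans (cong length (select-++ h a b c)) (length-++ (select h a b))

count-shift : ∀ h c a b → count h (c + a) b ≡ count (λ r → h (c + r)) a b
count-shift h c a zero = refl
count-shift h c a (suc b) with h (c + a)
... | true  = cong suc (trans (cong (λ z → count h z b) (sym (+-suc c a))) (count-shift h c (suc a) b))
... | false = trans (cong (λ z → count h z b) (sym (+-suc c a))) (count-shift h c (suc a) b)

count-flip : ∀ h h' a b d → InRange a b d → h d ≡ false → h' d ≡ true →
  (∀ x → x ≢ d → h x ≡ h' x) → count h' a b ≡ suc (count h a b)
count-flip h h' a zero    d r _ _ _ = ⊥-elim (InRange-empty r)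
count-flip h h' a (suc b) d r hd h'd e with a ≟ d
... | yes refl rewrite hd | h'd =
  cong suc (cong length (select-cong (suc a) b (λ x r' → sym (e x (>⇒≢ (proj₁ r'))))))
... | no a≢d rewrite e a a≢d with h' a
...   | true  = cong suc (count-flip h h' (suc a) b d (InRange-step r a≢d) hd h'd e)
...   | false = count-flip h h' (suc a) b d (InRange-step r a≢d) hd h'd e

select-<ᵇ : ∀ {c n} → c ≤ n → select (_<ᵇ c) 0 n ≡ range 0 c
select-<ᵇ {c} {n} c≤n = begin
  select (_<ᵇ c) 0 n                              ≡⟨ cong (select (_<ᵇ c) 0) (m+[n∸m]≡n c≤n) ⟨
  select (_<ᵇ c) 0 (c + (n ∸ c))                  ≡⟨ select-++ (_<ᵇ c) 0 c (n ∸ c) ⟩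
  select (_<ᵇ c) 0 c ++ select (_<ᵇ c) c (n ∸ c)  ≡⟨ cong₂ _++_ (select-all _ 0 c (λ x r → <ᵇ-true (proj₂ r)))
                                                                (select-none _ c (n ∸ c) (λ x r → <ᵇ-false (proj₁ r))) ⟩
  range 0 c ++ []                                 ≡⟨ ++-identityʳ (range 0 c) ⟩
  range 0 c                                       ∎
  where open ≡-Reasoning

count-<ᵇ : ∀ {c n} → c ≤ n → count (_<ᵇ c) 0 n ≡ c
count-<ᵇ {c} c≤n = trans (cong length (select-<ᵇ c≤n)) (length-range 0 c)

gapAt : ℕ → ℕ → Bool
gapAt j r = (r <ᵇ j) ∨ (r ≡ᵇ suc j)

gapAt-< : ∀ {j r} → r < j → gapAt j r ≡ true
gapAt-< r<j rewrite <ᵇ-true r<j = refl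

gapAt-suc : ∀ j → gapAt j (suc j) ≡ true
gapAt-suc j rewrite <ᵇ-false {suc j} {j} (n≤1+n j) | ≡ᵇ-true {suc j} refl = refl

gapAt-false : ∀ {j r} → j ≤ r → r ≢ suc j → gapAt j r ≡ false
gapAt-false j≤r r≢1+j rewrite <ᵇ-false j≤r | ≡ᵇ-false r≢1+j = refl

gapAt-gap : ∀ j → gapAt j j ≡ false
gapAt-gap j = gapAt-false ≤-refl (<⇒≢ (n<1+n j))

select-gapAt : ∀ {j n} → 2 + j ≤ n → select (gapAt j) 0 n ≡ range 0 j ++ [ suc j ]
select-gapAt {j} {n} 2+j≤n = begin
  select (gapAt j) 0 n                                   ≡⟨ cong (select (gapAt j) 0) (m+[n∸m]≡n j≤n) ⟨
  select (gapAt j) 0 (j + (n ∸ j))                       ≡⟨ select-++ (gapAt j) 0 j (n ∸ j) ⟩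
  select (gapAt j) 0 j ++ select (gapAt j) j (n ∸ j)     ≡⟨ cong₂ _++_ (select-all _ 0 j (λ x r → gapAt-< (proj₂ r))) tail ⟩
  range 0 j ++ [ suc j ]                                 ∎
  where
    open ≡-Reasoning
    j≤n : j ≤ n
    j≤n = ≤-trans (n≤1+n j) (≤-trans (n≤1+n (suc j)) 2+j≤n)
    n∸j≡2+rest : n ∸ j ≡ 2 + (n ∸ (2 + j))
    n∸j≡2+rest = begin
      n ∸ j                             ≡⟨ cong (_∸ j) (m∸n+n≡m 2+j≤n) ⟨
      (n ∸ (2 + j)) + (2 + j) ∸ j       ≡⟨ +-∸-assoc (n ∸ (2 + j)) (m≤n+m j 2) ⟩
      (n ∸ (2 + j)) + (2 + j ∸ j)       ≡⟨ cong ((n ∸ (2 + j)) +_) (m+n∸n≡m 2 j) ⟩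
      (n ∸ (2 + j)) + 2                 ≡⟨ +-comm (n ∸ (2 + j)) 2 ⟩
      2 + (n ∸ (2 + j))                 ∎
    tail : select (gapAt j) j (n ∸ j) ≡ [ suc j ]
    tail rewrite n∸j≡2+rest | gapAt-gap j | gapAt-suc j =
      cong (suc j ∷_) (select-none _ (2 + j) (n ∸ (2 + j))
        (λ x r → gapAt-false (≤-trans (n≤1+n j) (<⇒≤ (proj₁ r))) (λ e → <⇒≢ (proj₁ r) (sym e))))

count-gapAt : ∀ {j n} → 2 + j ≤ n → count (gapAt j) 0 n ≡ suc j
count-gapAt {j} 2+j≤n = trans (cong length (select-gapAt 2+j≤n))
  (trans (length-++ (range 0 j)) (trans (cong (_+ 1) (length-range 0 j)) (+-comm j 1)))

∈-range⁻ : ∀ a b {x} → x ∈ₗ range a b → InRange a b x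
∈-range⁻ a (suc b) (here refl) = InRange-head a b
∈-range⁻ a (suc b) (there m)   = InRange-tail (∈-range⁻ (suc a) b m)

∈-range⁺ : ∀ a b {x} → InRange a b x → x ∈ₗ range a b
∈-range⁺ a zero    r = ⊥-elim (InRange-empty r)
∈-range⁺ a (suc b) {x} r with a ≟ x
... | yes refl = here refl
... | no a≢x   = there (∈-range⁺ (suc a) b (InRange-step r a≢x))

range-≤-Ascending : ∀ {a xs} → Ascending a xs → Pointwise _≤_ (range a (length xs)) xs
range-≤-Ascending []       = []
range-≤-Ascending (p ∷ ps) = p ∷ range-≤-Ascending (Ascending-weaken (s≤s p) ps)

Pointwise-≤-last : ∀ ys {c xs} → Pointwise _≤_ (ys ++ [ c ]) xs → ∃ λ x → x ∈ₗ xs × c ≤ x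
Pointwise-≤-last []       (p ∷ []) = _ , here refl , p
Pointwise-≤-last (y ∷ ys) (p ∷ ps) =
  let (x , m , q) = Pointwise-≤-last ys ps in x , there m , q

Ascending-large-in-tail : ∀ {x xs w c} j → Ascending (suc x) xs → length xs ≡ suc j →
  w ∈ₗ (x ∷ xs) → c ≤ w → ∃ λ y → y ∈ₗ xs × c ≤ y
Ascending-large-in-tail j ps e (there m) p = _ , m , p
Ascending-large-in-tail {xs = y ∷ ys} j (x<y ∷ _) e (here refl) p = y , here refl , ≤-trans p (<⇒≤ x<y)

range∷-≤-Ascending : ∀ {a} j xs → Ascending a xs → length xs ≡ suc j →
  (∃ λ x → x ∈ₗ xs × a + suc j ≤ x) → Pointwise _≤_ (range a j ++ [ a + suc j ]) xs
range∷-≤-Ascending zero (x ∷ []) ps refl (w , here refl , p) = p ∷ []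
range∷-≤-Ascending {a} (suc j) (x ∷ xs) (a≤x ∷ ps) e (w , m , p) =
  a≤x ∷ subst (λ z → Pointwise _≤_ (range (suc a) j ++ [ z ]) xs) (sym a+2+j≡1+a+1+j)
    (range∷-≤-Ascending j xs (Ascending-weaken (s≤s a≤x) ps) (suc-injective e)
      (Ascending-large-in-tail j ps (suc-injective e) m (subst (_≤ w) a+2+j≡1+a+1+j p)))
  where
    a+2+j≡1+a+1+j : a + suc (suc j) ≡ suc a + suc j
    a+2+j≡1+a+1+j = +-suc a (suc j)

Pointwise-≤-range-prefix : ∀ {a} j {ys} xs → Ascending a xs → Pointwise _≤_ xs (range a j ++ ys) →
  ∃ λ zs → xs ≡ range a j ++ zs × Pointwise _≤_ zs ys × Ascending (a + j) zs
Pointwise-≤-range-prefix {a} zero xs ps le = xs , refl , le , subst (λ z → Ascending z xs) (sym (+-identityʳ a)) ps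
Pointwise-≤-range-prefix {a} (suc j) (x ∷ xs) (a≤x ∷ ps) (x≤a ∷ le) with ≤-antisym x≤a a≤x
... | refl =
  let (zs , e , le' , qs) = Pointwise-≤-range-prefix {suc a} j xs ps le
  in zs , cong (a ∷_) e , le' , subst (λ z → Ascending z zs) (sym (+-suc a j)) qs

Ascending-range-prefix : ∀ {a} j ys → Ascending a ys → (∀ i → i < j → a + i ∈ₗ ys) →
  ∃ λ rest → ys ≡ range a j ++ rest
Ascending-range-prefix zero ys ps f = ys , refl
Ascending-range-prefix {a} (suc j) [] ps f with f 0 z<s
... | ()
Ascending-range-prefix {a} (suc j) (y ∷ ys) (a≤y ∷ ps) f with f 0 z<s
... | there m = ⊥-elim (<⇒≱ (≤-trans (s≤s a≤y) (Ascending-∈ ps m)) (≤-reflexive (+-identityʳ a)))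
... | here e with trans (sym (+-identityʳ a)) e
...   | refl =
  let (rest , e') = Ascending-range-prefix {suc a} j ys ps later in rest , cong (a ∷_) e'
  where
    later : ∀ i → i < j → suc a + i ∈ₗ ys
    later i i<j with f (suc i) (s≤s i<j)
    ... | here e'  = ⊥-elim (<⇒≢ (m<m+n a z<s) (sym e'))
    ... | there m' = subst (_∈ₗ ys) (+-suc a i) m'

memℕ-extensionality : ∀ {n} (p q : Subset n) → (∀ x → x < n → memℕ p x ≡ memℕ q x) → p ≡ q
memℕ-extensionality []      []      e = refl
memℕ-extensionality (b ∷ p) (c ∷ q) e =
  cong₂ _∷_ (e 0 z<s) (memℕ-extensionality p q (λ x x<n → e (suc x) (s≤s x<n)))

∈⇒memℕ : ∀ {n} {p : Subset n} {x} → x ∈ p → memℕ p (toℕ x) ≡ true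
∈⇒memℕ here      = refl
∈⇒memℕ (there m) = ∈⇒memℕ m

memℕ⇒∈ : ∀ {n} {p : Subset n} {x} → memℕ p (toℕ x) ≡ true → x ∈ p
memℕ⇒∈ {p = true ∷ p} {zero}  e = here
memℕ⇒∈ {p = b ∷ p}    {suc x} e = there (memℕ⇒∈ e)

memℕ⇒∈-fromℕ< : ∀ {n} {p : Subset n} {x} (x<n : x < n) → memℕ p x ≡ true → fromℕ< x<n ∈ p
memℕ⇒∈-fromℕ< {p = p} x<n e = memℕ⇒∈ (subst (λ z → memℕ p z ≡ true) (sym (toℕ-fromℕ< x<n)) e)

∉⇒memℕ : ∀ {n} {p : Subset n} {x} → x ∉ p → memℕ p (toℕ x) ≡ false
∉⇒memℕ {p = p} {x} x∉p with memℕ p (toℕ x) in e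
... | false = refl
... | true  = ⊥-elim (x∉p (memℕ⇒∈ e))

⊆⇒memℕ : ∀ {n} {p q : Subset n} → p ⊆ q → ∀ {x} → x < n → memℕ p x ≡ true → memℕ q x ≡ true
⊆⇒memℕ {q = q} p⊆q x<n e =
  subst (λ z → memℕ q z ≡ true) (toℕ-fromℕ< x<n) (∈⇒memℕ (p⊆q (memℕ⇒∈-fromℕ< x<n e)))

memℕ⇒⊆ : ∀ {n} {p q : Subset n} → (∀ x → x < n → memℕ p x ≡ true → memℕ q x ≡ true) → p ⊆ q
memℕ⇒⊆ h {x} m = memℕ⇒∈ (h (toℕ x) (toℕ<n x) (∈⇒memℕ m))

⊆-∣∣-antisym : ∀ {n} {p q : Subset n} → p ⊆ q → ∣ p ∣ ≡ ∣ q ∣ → q ⊆ p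
⊆-∣∣-antisym {p = p} p⊆q e {x} x∈q with x ∈? p
... | yes x∈p = x∈p
... | no  x∉p = ⊥-elim (<⇒≢ (p⊂q⇒∣p∣<∣q∣ (p⊆q , x , x∈q , x∉p)) e)

tabulateℕ : (n : ℕ) → (ℕ → Bool) → Subset n
tabulateℕ zero    f = []
tabulateℕ (suc n) f = f 0 ∷ tabulateℕ n (f ∘ suc)

memℕ-tabulateℕ : ∀ n f {x} → x < n → memℕ (tabulateℕ n f) x ≡ f x
memℕ-tabulateℕ (suc n) f {zero}  _         = refl
memℕ-tabulateℕ (suc n) f {suc x} (s≤s x<n) = memℕ-tabulateℕ n (f ∘ suc) x<n

memℕ-tabulate : ∀ {n} (f : Fin n → Bool) (t : Fin n) → memℕ (tabulate f) (toℕ t) ≡ f t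
memℕ-tabulate f zero    = refl
memℕ-tabulate f (suc t) = memℕ-tabulate (f ∘ suc) t

∣p∣≡count : ∀ {n} (p : Subset n) → ∣ p ∣ ≡ count (memℕ p) 0 n
∣p∣≡count []                = refl
∣p∣≡count {suc n} (true ∷ p)  = cong suc (trans (∣p∣≡count p) (sym (count-shift (memℕ (true ∷ p)) 1 0 n)))
∣p∣≡count {suc n} (false ∷ p) = trans (∣p∣≡count p) (sym (count-shift (memℕ (false ∷ p)) 1 0 n))

memℕ-∁ : ∀ {n} (p : Subset n) {x} → x < n → memℕ (∁ p) x ≡ not (memℕ p x)
memℕ-∁ (b ∷ p) {zero}  _         = refl
memℕ-∁ (b ∷ p) {suc x} (s≤s x<n) = memℕ-∁ p x<n

memℕ-∪ : ∀ {n} (p q : Subset n) x → memℕ (p ∪ q) x ≡ (memℕ p x ∨ memℕ q x)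
memℕ-∪ []      []      x       = refl
memℕ-∪ (b ∷ p) (c ∷ q) zero    = refl
memℕ-∪ (b ∷ p) (c ∷ q) (suc x) = memℕ-∪ p q x

memℕ-⊥ : ∀ n x → memℕ (∅ {n}) x ≡ false
memℕ-⊥ zero    x       = refl
memℕ-⊥ (suc n) zero    = refl
memℕ-⊥ (suc n) (suc x) = memℕ-⊥ n x

memℕ-⁅⁆ : ∀ {n} (i : Fin n) x → memℕ ⁅ i ⁆ x ≡ (x ≡ᵇ toℕ i)
memℕ-⁅⁆         zero    zero    = refl
memℕ-⁅⁆ {suc n} zero    (suc x) = memℕ-⊥ n x
memℕ-⁅⁆         (suc i) zero    = refl
memℕ-⁅⁆         (suc i) (suc x) = memℕ-⁅⁆ i x

memℕ-─⊥ : ∀ {n} (p : Subset n) x → memℕ (p ─ ∅) x ≡ memℕ p x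
memℕ-─⊥ []      x       = refl
memℕ-─⊥ (b ∷ p) zero    = refl
memℕ-─⊥ (b ∷ p) (suc x) = memℕ-─⊥ p x

memℕ-remove : ∀ {n} (p : Subset n) (i : Fin n) x → memℕ (p - i) x ≡ (memℕ p x ∧ not (x ≡ᵇ toℕ i))
memℕ-remove (true  ∷ p) zero    zero    = refl
memℕ-remove (false ∷ p) zero    zero    = refl
memℕ-remove (b ∷ p)     zero    (suc x) = trans (memℕ-─⊥ p x) (sym (∧-identityʳ (memℕ p x)))
memℕ-remove (true  ∷ p) (suc i) zero    = refl
memℕ-remove (false ∷ p) (suc i) zero    = refl
memℕ-remove (b ∷ p)     (suc i) (suc x) = memℕ-remove p i x

⊆-extend : ∀ {n} (C : Subset n) {c} → ∣ C ∣ ≤ c → c ≤ n → ∃ λ Z → C ⊆ Z × ∣ Z ∣ ≡ c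
⊆-extend [] {zero} _ _ = [] , (λ ()) , refl
⊆-extend (true ∷ C) {suc c} (s≤s p) (s≤s q) =
  let (Z , C⊆Z , e) = ⊆-extend C p q in true ∷ Z , s⊆s C⊆Z , cong suc e
⊆-extend {suc n} (false ∷ C) {c} p q with m≤n⇒m<n∨m≡n q
... | inj₁ (s≤s q') = let (Z , C⊆Z , e) = ⊆-extend C p q' in false ∷ Z , s⊆s C⊆Z , e
... | inj₂ refl     = let (Z , C⊆Z , e) = ⊆-extend C (∣p∣≤n C) ≤-refl in true ∷ Z , out⊆ C⊆Z , cong suc e

⊈⇒∃∈∖ : ∀ {n} {p q : Subset n} → ¬ p ⊆ q → ∃ λ x → x ∈ p × x ∉ q
⊈⇒∃∈∖ {p = p} {q} p⊈q with any? (λ x → (x ∈? p) ×-dec ¬? (x ∈? q))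
... | yes found = found
... | no  none  = ⊥-elim (p⊈q p⊆q)
  where
    p⊆q : p ⊆ q
    p⊆q {x} x∈p with x ∈? q
    ... | yes x∈q = x∈q
    ... | no  x∉q = ⊥-elim (none (x , x∈p , x∉q))

∣p∣<∣q∣⇒∃∈q∖p : ∀ {n} {p q : Subset n} → ∣ p ∣ < ∣ q ∣ → ∃ λ x → x ∈ q × x ∉ p
∣p∣<∣q∣⇒∃∈q∖p ∣p∣<∣q∣ = ⊈⇒∃∈∖ (λ q⊆p → <⇒≱ ∣p∣<∣q∣ (p⊆q⇒∣p∣≤∣q∣ q⊆p))

independent? : ∀ {n} (B : Family n) X → Dec (Independent B X)
independent? B X = anySubset? (λ Y → (B Y ≟ᵇ true) ×-dec (X ⊆? Y))

-- A smallest dependent set is a circuit.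
small-sets-independent : ∀ {n} (B : Family n) {c} → (∀ C → IsCircuit B C → c ≤ ∣ C ∣) →
  ∀ X → ∣ X ∣ < c → Independent B X
small-sets-independent B {c} large X = go ∣ X ∣ X ≤-refl
  where
    go : ∀ s X → ∣ X ∣ ≤ s → ∣ X ∣ < c → Independent B X
    go s X ∣X∣≤s ∣X∣<c with independent? B X
    ... | yes ind = ind
    ... | no  dep = ⊥-elim (<⇒≱ ∣X∣<c (large X (dep , proper-independent s ∣X∣≤s)))
      where
        proper-independent : ∀ s → ∣ X ∣ ≤ s → ∀ D → D ⊂ X → Independent B D
        proper-independent zero    ∣X∣≤0  D D⊂X = ⊥-elim (n≮0 (≤-trans (p⊂q⇒∣p∣<∣q∣ D⊂X) ∣X∣≤0))
        proper-independent (suc s) ∣X∣≤1+s D D⊂X =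
          go s D (s≤s⁻¹ (≤-trans (p⊂q⇒∣p∣<∣q∣ D⊂X) ∣X∣≤1+s)) (<-trans (p⊂q⇒∣p∣<∣q∣ D⊂X) ∣X∣<c)

concatMap-select : ∀ h (g : ℕ → ℕ) a b → (∀ i → g i ≡ a + i) →
  concatMap (λ r → if h r then r ∷ [] else []) (applyUpTo g b) ≡ select h a b
concatMap-select h g a zero    e = refl
concatMap-select h g a (suc b) e rewrite e 0 | +-identityʳ a with h a
... | true  = cong (a ∷_) (concatMap-select h (g ∘ suc) (suc a) b (λ i → trans (e (suc i)) (+-suc a i)))
... | false = concatMap-select h (g ∘ suc) (suc a) b (λ i → trans (e (suc i)) (+-suc a i))

wrap≡% : ∀ n .{{_ : NonZero n}} {x} → x < n + n → wrap n x ≡ x % n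
wrap≡% n {x} x<2n with x <? n
... | yes x<n rewrite <ᵇ-true x<n = sym (m<n⇒m%n≡m x<n)
... | no  x≮n rewrite <ᵇ-false (≮⇒≥ x≮n) =
  sym (trans (cong (_% n) (sym (m∸n+n≡m (≮⇒≥ x≮n)))) (m<n⇒[m+n]%n≡m x∸n<n))
  where
    x∸n<n : x ∸ n < n
    x∸n<n = +-cancelʳ-< n (x ∸ n) n (subst (_< n + n) (sym (m∸n+n≡m (≮⇒≥ x≮n))) x<2n)

module Ranks (n : ℕ) {{_ : NonZero n}} where
  open Cyclic n

  tRanks-select : ∀ (t : Fin n) J → tRanks t J ≡ select (λ r → memℕ J (toℕ t ⊕ r)) 0 n
  tRanks-select t J = trans (concatMap-select _ (λ i → i) 0 n (λ i → refl))
    (select-cong 0 n (λ x r → cong (memℕ J) (wrap≡% n (+-mono-< (toℕ<n t) (proj₂ r)))))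

  count-rotate : ∀ h {s} → s ≤ n → count (λ r → h ((s + r) % n)) 0 n ≡ count h 0 n
  count-rotate h {s} s≤n = begin
    count f 0 n                             ≡⟨ cong (count f 0) (m∸n+n≡m s≤n) ⟨
    count f 0 ((n ∸ s) + s)                 ≡⟨ count-++ f 0 (n ∸ s) s ⟩
    count f 0 (n ∸ s) + count f (n ∸ s) s   ≡⟨ cong₂ _+_ before-wrap after-wrap ⟩
    count h s (n ∸ s) + count h 0 s         ≡⟨ +-comm (count h s (n ∸ s)) (count h 0 s) ⟩
    count h 0 s + count h (0 + s) (n ∸ s)   ≡⟨ count-++ h 0 s (n ∸ s) ⟨
    count h 0 (s + (n ∸ s))                 ≡⟨ cong (count h 0) (m+[n∸m]≡n s≤n) ⟩
    count h 0 n                             ∎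
    where
      open ≡-Reasoning
      f : ℕ → Bool
      f r = h ((s + r) % n)
      before-wrap : count f 0 (n ∸ s) ≡ count h s (n ∸ s)
      before-wrap = trans
        (cong length (select-cong 0 (n ∸ s) (λ x r →
          cong h (m<n⇒m%n≡m (subst (s + x <_) (m+[n∸m]≡n s≤n) (+-monoʳ-< s (proj₂ r)))))))
        (trans (sym (count-shift h s 0 (n ∸ s))) (cong (λ z → count h z (n ∸ s)) (+-identityʳ s)))
      after-wrap : count f (n ∸ s) s ≡ count h 0 s
      after-wrap = trans (cong (λ z → count f z s) (sym (+-identityʳ (n ∸ s))))
        (trans (count-shift f (n ∸ s) 0 s) (cong length (select-cong 0 s (λ x r →
          cong h (trans (cong (_% n) (s+[[n∸s]+x]≡x+n x)) (m<n⇒[m+n]%n≡m (≤-trans (proj₂ r) s≤n)))))))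
        where
          s+[[n∸s]+x]≡x+n : ∀ x → s + ((n ∸ s) + x) ≡ x + n
          s+[[n∸s]+x]≡x+n x = trans (sym (+-assoc s (n ∸ s) x)) (trans (cong (_+ x) (m+[n∸m]≡n s≤n)) (+-comm n x))

  length-tRanks : ∀ (t : Fin n) J → length (tRanks t J) ≡ ∣ J ∣
  length-tRanks t J = trans (cong length (tRanks-select t J))
    (trans (count-rotate (memℕ J) (<⇒≤ (toℕ<n t))) (sym (∣p∣≡count J)))

  relative : ℕ → (ℕ → Bool) → Subset n
  relative t f = tabulateℕ n (λ y → f (offset t y))

  memℕ-relative : ∀ t f {y} → y < n → memℕ (relative t f) y ≡ f (offset t y)
  memℕ-relative t f = memℕ-tabulateℕ n _

  memℕ-relative-⊕ : ∀ {t} f {r} → t ≤ n → r < n → memℕ (relative t f) (t ⊕ r) ≡ f r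
  memℕ-relative-⊕ {t} f t≤n r<n = trans (memℕ-relative t f (⊕<n t _)) (cong f (offset-⊕ t≤n r<n))

  ∣relative∣ : ∀ {t} f → t ≤ n → ∣ relative t f ∣ ≡ count f 0 n
  ∣relative∣ {t} f t≤n = trans (∣p∣≡count (relative t f))
    (trans (cong length (select-cong 0 n (λ x r → trans (memℕ-relative t f (proj₂ r))
                                              (cong f (cong (_% n) (+-comm x (n ∸ t)))))))
           (count-rotate f (m∸n≤m n t)))

  tRanks-relative : ∀ (t : Fin n) f → tRanks t (relative (toℕ t) f) ≡ select f 0 n
  tRanks-relative t f = trans (tRanks-select t (relative (toℕ t) f))
    (select-cong 0 n (λ x r → memℕ-relative-⊕ f (<⇒≤ (toℕ<n t)) (proj₂ r)))

module _ {m : ℕ} where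
  open Cyclic (suc m)

  toℕ-csuc : ∀ (i : Fin (suc m)) → toℕ (csuc i) ≡ toℕ i ⊕ 1
  toℕ-csuc i with toℕ i <? m
  ... | yes i<m = trans (cong suc (toℕ-fromℕ< i<m))
    (trans (+-comm 1 (toℕ i)) (sym (m<n⇒m%n≡m (subst (_< suc m) (+-comm 1 (toℕ i)) (s≤s i<m)))))
  ... | no  i≮m = sym (trans (cong (λ z → (z + 1) % suc m) (≤-antisym (s≤s⁻¹ (toℕ<n i)) (≮⇒≥ i≮m)))
    (trans (cong (_% suc m) (+-comm m 1)) (n%n≡0 (suc m))))

  toℕ-cpred : ∀ (i : Fin (suc m)) → toℕ (cpred i) ≡ toℕ i ⊕ m
  toℕ-cpred zero    = trans (toℕ-fromℕ m) (sym (m<n⇒m%n≡m (n<1+n m)))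
  toℕ-cpred (suc i) = trans (toℕ-inject₁ i) (sym (trans (cong (_% suc m) (sym (+-suc (toℕ i) m)))
    (m<n⇒[m+n]%n≡m (≤-trans (toℕ<n i) (n≤1+n m)))))

  csuc-cpred : ∀ (i : Fin (suc m)) → csuc (cpred i) ≡ i
  csuc-cpred i = toℕ-injective (begin
    toℕ (csuc (cpred i))    ≡⟨ toℕ-csuc (cpred i) ⟩
    toℕ (cpred i) ⊕ 1       ≡⟨ cong (_⊕ 1) (toℕ-cpred i) ⟩
    (toℕ i ⊕ m) ⊕ 1         ≡⟨ [m%n+o]%n≡[m+o]%n (toℕ i + m) 1 (suc m) ⟩
    (toℕ i + m + 1) % suc m ≡⟨ cong (_% suc m) (trans (+-assoc (toℕ i) m 1) (cong (toℕ i +_) (+-comm m 1))) ⟩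
    (toℕ i + suc m) % suc m ≡⟨ m<n⇒[m+n]%n≡m (toℕ<n i) ⟩
    toℕ i                   ∎)
    where open ≡-Reasoning

module Intervals (n : ℕ) {{_ : NonZero n}} where
  open Cyclic n
  open Ranks n

  interval : ℕ → ℕ → Subset n
  interval c t = relative t (_<ᵇ c)

  ∣interval∣ : ∀ {c t} → c ≤ n → t ≤ n → ∣ interval c t ∣ ≡ c
  ∣interval∣ c≤n t≤n = trans (∣relative∣ _ t≤n) (count-<ᵇ c≤n)

  memℕ-interval : ∀ c t {y} → y < n → memℕ (interval c t) y ≡ (offset t y <ᵇ c)
  memℕ-interval c t = memℕ-relative t (_<ᵇ c)

  LeavesInterval : ℕ → ℕ → Subset n → Set
  LeavesInterval c t J = ∃ λ y → y < n × memℕ J y ≡ true × c ≤ offset t y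

  tRanks-Ascending : ∀ (t : Fin n) J → Ascending 0 (tRanks t J)
  tRanks-Ascending t J = subst (Ascending 0) (sym (tRanks-select t J)) (select-Ascending _ 0 n)

  ∈-tRanks⁻ : ∀ (t : Fin n) J {r} → r ∈ₗ tRanks t J → r < n × memℕ J (toℕ t ⊕ r) ≡ true
  ∈-tRanks⁻ t J m = let ((_ , r<n) , e) = ∈-select⁻ _ 0 n (subst (_ ∈ₗ_) (tRanks-select t J) m) in r<n , e

  ∈-tRanks⁺ : ∀ (t : Fin n) J {r} → r < n → memℕ J (toℕ t ⊕ r) ≡ true → r ∈ₗ tRanks t J
  ∈-tRanks⁺ t J r<n e = subst (_ ∈ₗ_) (sym (tRanks-select t J)) (∈-select⁺ _ 0 n (z≤n , r<n) e)

  tRanks-injective : ∀ (t : Fin n) {I J} → tRanks t I ≡ tRanks t J → I ≡ J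
  tRanks-injective t {I} {J} e = memℕ-extensionality I J λ y y<n →
    let r<n = offset<n (toℕ t) y
        at-y : ∀ K → memℕ K (toℕ t ⊕ offset (toℕ t) y) ≡ memℕ K y
        at-y K = cong (memℕ K) (⊕-offset (<⇒≤ (toℕ<n t)) y<n)
    in trans (sym (at-y I)) (trans
         (≡-Bool (λ m → proj₂ (∈-tRanks⁻ t J (subst (_ ∈ₗ_) e (∈-tRanks⁺ t I r<n m))))
                 (λ m → proj₂ (∈-tRanks⁻ t I (subst (_ ∈ₗ_) (sym e) (∈-tRanks⁺ t J r<n m)))))
         (at-y J))

  gapped : ℕ → ℕ → Subset n
  gapped j t = relative t (gapAt j)

  ∣gapped∣ : ∀ {j t} → 2 + j ≤ n → t ≤ n → ∣ gapped j t ∣ ≡ suc j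
  ∣gapped∣ 2+j≤n t≤n = trans (∣relative∣ _ t≤n) (count-gapAt 2+j≤n)

  tRanks-interval : ∀ (t : Fin n) {c} → c ≤ n → tRanks t (interval c (toℕ t)) ≡ range 0 c
  tRanks-interval t c≤n = trans (tRanks-relative t _) (select-<ᵇ c≤n)

  tRanks-gapped : ∀ (t : Fin n) {j} → 2 + j ≤ n → tRanks t (gapped j (toℕ t)) ≡ range 0 j ++ [ suc j ]
  tRanks-gapped t 2+j≤n = trans (tRanks-relative t _) (select-gapAt 2+j≤n)

  interval-≤ₜ : ∀ (t : Fin n) {c J} → c ≤ n → ∣ J ∣ ≡ c → GaleLe t (interval c (toℕ t)) J
  interval-≤ₜ t {c} {J} c≤n ∣J∣≡c rewrite tRanks-interval t c≤n =
    subst (λ z → Pointwise _≤_ (range 0 z) (tRanks t J)) (trans (length-tRanks t J) ∣J∣≡c)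
      (range-≤-Ascending (tRanks-Ascending t J))

  gapped-≤ₜ : ∀ (t : Fin n) {j J} → 2 + j ≤ n → ∣ J ∣ ≡ suc j →
    LeavesInterval (suc j) (toℕ t) J → GaleLe t (gapped j (toℕ t)) J
  gapped-≤ₜ t {j} {J} 2+j≤n ∣J∣≡1+j (y , y<n , y∈J , 1+j≤y) rewrite tRanks-gapped t 2+j≤n =
    range∷-≤-Ascending j (tRanks t J) (tRanks-Ascending t J) (trans (length-tRanks t J) ∣J∣≡1+j)
      (offset (toℕ t) y , ∈-tRanks⁺ t J (offset<n (toℕ t) y)
         (trans (cong (memℕ J) (⊕-offset (<⇒≤ (toℕ<n t)) y<n)) y∈J) , 1+j≤y)

  gapped-≤ₜ⁻ : ∀ (t : Fin n) {j J} → 2 + j ≤ n → GaleLe t (gapped j (toℕ t)) J →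
    LeavesInterval (suc j) (toℕ t) J
  gapped-≤ₜ⁻ t {j} {J} 2+j≤n le
    with Pointwise-≤-last (range 0 j) (subst (λ xs → Pointwise _≤_ xs (tRanks t J)) (tRanks-gapped t 2+j≤n) le)
  ... | r , r∈J , 1+j≤r = let (r<n , e) = ∈-tRanks⁻ t J r∈J in
    toℕ t ⊕ r , ⊕<n (toℕ t) r , e , subst (suc j ≤_) (sym (offset-⊕ (<⇒≤ (toℕ<n t)) r<n)) 1+j≤r

  tRanks-range-prefix : ∀ (t : Fin n) {j Y} → j < n → (∀ r → r < j → memℕ Y (toℕ t ⊕ r) ≡ true) →
    ∣ Y ∣ ≡ suc j → ∃ λ p → tRanks t Y ≡ range 0 j ++ [ p ]
  tRanks-range-prefix t {j} {Y} j<n prefix ∣Y∣≡1+j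
    with Ascending-range-prefix j (tRanks t Y) (tRanks-Ascending t Y)
           (λ r r<j → ∈-tRanks⁺ t Y (<-trans r<j j<n) (prefix r r<j))
  ... | rest , e = singleton rest length-rest , trans e (cong (range 0 j ++_) (singleton-≡ rest length-rest))
    where
      length-rest : length rest ≡ 1
      length-rest = +-cancelˡ-≡ j (length rest) 1 (begin
        j + length rest                  ≡⟨ cong (_+ length rest) (length-range 0 j) ⟨
        length (range 0 j) + length rest ≡⟨ length-++ (range 0 j) ⟨
        length (range 0 j ++ rest)       ≡⟨ cong length e ⟨
        length (tRanks t Y)              ≡⟨ length-tRanks t Y ⟩
        ∣ Y ∣                            ≡⟨ ∣Y∣≡1+j ⟩
        suc j                            ≡⟨ +-comm 1 j ⟩
        j + 1                            ∎)
        where open ≡-Reasoning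
      singleton : (xs : List ℕ) → length xs ≡ 1 → ℕ
      singleton (x ∷ []) _ = x
      singleton-≡ : (xs : List ℕ) (e : length xs ≡ 1) → xs ≡ [ singleton xs e ]
      singleton-≡ (x ∷ []) _ = refl

  Gale-below-range∷ : ∀ (t : Fin n) {j I Y p} → tRanks t Y ≡ range 0 j ++ [ p ] → GaleLe t I Y →
    ∃ λ q → tRanks t I ≡ range 0 j ++ [ q ] × j ≤ q
  Gale-below-range∷ t {j} {I} e le
    with Pointwise-≤-range-prefix j (tRanks t I) (tRanks-Ascending t I) (subst (Pointwise _≤_ (tRanks t I)) e le)
  ... | q ∷ [] , e' , _ ∷ [] , j≤q ∷ _ = q , e' , j≤q

  Gale-above-last : ∀ (t : Fin n) {j I Z q c} → tRanks t I ≡ range 0 j ++ [ q ] → GaleLe t I Z →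
    (∀ y → y < n → memℕ Z y ≡ true → offset (toℕ t) y ≤ c) → q ≤ c
  Gale-above-last t {j} {I} {Z} e le bound
    with Pointwise-≤-last (range 0 j) (subst (λ xs → Pointwise _≤_ xs (tRanks t Z)) e le)
  ... | r , r∈Z , q≤r = let (r<n , m) = ∈-tRanks⁻ t Z r∈Z in
    ≤-trans q≤r (subst (_≤ _) (offset-⊕ (<⇒≤ (toℕ<n t)) r<n) (bound (toℕ t ⊕ r) (⊕<n (toℕ t) r) m))

  -- Y forces the ranks of I to begin with 0, …, j-1; Z caps its last rank at j + 1.
  Gale-squeezed : ∀ (t : Fin n) {j I Y Z} → 2 + j ≤ n →
    (∀ r → r < j → memℕ Y (toℕ t ⊕ r) ≡ true) → ∣ Y ∣ ≡ suc j → GaleLe t I Y →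
    (∀ y → y < n → memℕ Z y ≡ true → offset (toℕ t) y ≤ suc j) → GaleLe t I Z →
    I ≡ interval (suc j) (toℕ t) ⊎ I ≡ gapped j (toℕ t)
  Gale-squeezed t {j} {I} {Y} {Z} 2+j≤n prefix ∣Y∣ I≤Y bound I≤Z
    with tRanks-range-prefix t {Y = Y} (≤-trans (n≤1+n (suc j)) 2+j≤n) prefix ∣Y∣
  ... | p , eY with Gale-below-range∷ t {I = I} {Y = Y} eY I≤Y
  ... | q , eI , j≤q with m≤n⇒m<n∨m≡n j≤q | Gale-above-last t {I = I} {Z = Z} eI I≤Z bound
  ...   | inj₂ refl | _ = inj₁ (tRanks-injective t (trans eI (sym (trans
            (tRanks-interval t (≤-trans (n≤1+n (suc j)) 2+j≤n)) (range-suc 0 j)))))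
  ...   | inj₁ j<q | q≤1+j with ≤-antisym q≤1+j j<q
  ...     | refl = inj₂ (tRanks-injective t (trans eI (sym (tRanks-gapped t 2+j≤n))))

  NonAdjacentℕ : (ℕ → Bool) → Set
  NonAdjacentℕ a = ∀ t → t < n → a t ≡ true → a (t ⊕ 1) ≡ true → ⊥

  interval-entry : ∀ {c s g} → s < n → c ≤ offset s g → offset s (g ⊕ 1) < c → g ⊕ 1 ≡ s
  interval-entry {c} {s} {g} s<n c≤g g+1<c with suc (offset s g) <? n
  ... | yes g+1<n = ⊥-elim (<⇒≱ g+1<c (≤-trans c≤g (≤-trans (n≤1+n _) (≤-reflexive (sym (offset-suc-< s g g+1<n))))))
  ... | no  g+1≮n = offset≡0⇒≡ s<n (⊕<n g 1) (offset-suc-≡n s g (≤-antisym (offset<n s g) (≮⇒≥ g+1≮n)))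

  punctured : ℕ → ℕ → ℕ → Subset n
  punctured c t d = relative t (λ r → (r <ᵇ suc c) ∧ not (r ≡ᵇ d))

  ∣punctured∣ : ∀ {c t d} → t ≤ n → d < c → suc c ≤ n → ∣ punctured c t d ∣ ≡ c
  ∣punctured∣ {c} {t} {d} t≤n d<c 1+c≤n = suc-injective (begin
    suc ∣ punctured c t d ∣         ≡⟨ cong suc (∣relative∣ f t≤n) ⟩
    suc (count f 0 n)               ≡⟨ count-flip f (_<ᵇ suc c) 0 n d (z≤n , <-trans d<c 1+c≤n) f-d
                                         (<ᵇ-true (m<n⇒m<1+n d<c)) agree ⟨
    count (_<ᵇ suc c) 0 n           ≡⟨ count-<ᵇ 1+c≤n ⟩
    suc c                           ∎)
    where
      open ≡-Reasoning
      f : ℕ → Bool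
      f r = (r <ᵇ suc c) ∧ not (r ≡ᵇ d)
      f-d : f d ≡ false
      f-d rewrite ≡ᵇ-true {d} refl = ∧-zeroʳ (d <ᵇ suc c)
      agree : ∀ r → r ≢ d → f r ≡ (r <ᵇ suc c)
      agree r r≢d rewrite ≡ᵇ-false r≢d = ∧-identityʳ (r <ᵇ suc c)

  punctured-⊇ : ∀ {c t C x} → t < n → x < n → C ⊆ interval c t → memℕ C x ≡ false →
    C ⊆ punctured c t (offset t x)
  punctured-⊇ {c} {t} {C} {x} t<n x<n C⊆I x∉C = memℕ⇒⊆ λ y y<n y∈C →
    let y-in : offset t y < c
        y-in = <ᵇ-true⁻ (trans (sym (memℕ-interval c t y<n)) (⊆⇒memℕ C⊆I y<n y∈C))
        y≢x : offset t y ≢ offset t x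
        y≢x e = true≢false (trans (sym y∈C) (trans (cong (memℕ C) (offset-injective (<⇒≤ t<n) y<n x<n e)) x∉C))
    in trans (memℕ-relative t (λ r → (r <ᵇ suc c) ∧ not (r ≡ᵇ offset t x)) y<n)
         (subst (λ b → (offset t y <ᵇ suc c) ∧ b ≡ true) (sym (cong not (≡ᵇ-false y≢x)))
                (trans (∧-identityʳ _) (<ᵇ-true (m<n⇒m<1+n y-in))))

  -- Puncturing an interval at x ∈ [t, t+c) and appending t+c creates two entry points, x+1 and
  -- (unless x = t) t itself; an interval has only one, and x = t would force t, t+1 ∈ a.
  punctured-not-interval : ∀ {c t x s} (a : ℕ → Bool) → NonAdjacentℕ a → 2 + c ≤ n →
    t < n → a t ≡ true → x < n → offset t x < c → s < n → a s ≡ true →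
    punctured c t (offset t x) ≢ interval c s
  punctured-not-interval {c} {t} {x} {s} a nonadj 2+c≤n t<n t∈a x<n d<c s<n s∈a P≡I = cases
    where
      d : ℕ
      d = offset t x
      f : ℕ → Bool
      f r = (r <ᵇ suc c) ∧ not (r ≡ᵇ d)
      f-true : ∀ {r} → r < suc c → r ≢ d → f r ≡ true
      f-true r≤c r≢d rewrite <ᵇ-true r≤c | ≡ᵇ-false r≢d = refl
      memℕ-I : ∀ {y} → y < n → memℕ (interval c s) y ≡ f (offset t y)
      memℕ-I {y} y<n = trans (cong (λ Z → memℕ Z y) (sym P≡I)) (memℕ-relative t f y<n)
      entry : ∀ {g} → g < n → f (offset t g) ≡ false → f (offset t (g ⊕ 1)) ≡ true → g ⊕ 1 ≡ s
      entry {g} g<n g∉ g+1∈ = interval-entry {c = c} s<n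
        (<ᵇ-false⁻ (trans (sym (memℕ-interval c s g<n)) (trans (memℕ-I g<n) g∉)))
        (<ᵇ-true⁻ (trans (sym (memℕ-interval c s (⊕<n g 1))) (trans (memℕ-I (⊕<n g 1)) g+1∈)))
      d+1<n : suc d < n
      d+1<n = ≤-trans (s≤s d<c) (≤-trans (n≤1+n (suc c)) 2+c≤n)
      x+1≡s : x ⊕ 1 ≡ s
      x+1≡s = entry x<n (subst (λ b → (d <ᵇ suc c) ∧ not b ≡ false) (sym (≡ᵇ-true {d} refl)) (∧-zeroʳ _))
        (trans (cong f (offset-suc-< t x d+1<n)) (f-true (s≤s d<c) (λ e → <⇒≢ (n<1+n d) (sym e))))
      t-1 : ℕ
      t-1 = t ⊕ pred n
      t-1+1≡t : t-1 ⊕ 1 ≡ t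
      t-1+1≡t = offset≡0⇒≡ t<n (⊕<n t-1 1) (offset-suc-≡n t t-1
        (trans (cong suc (offset-⊕ (<⇒≤ t<n) (subst (pred n <_) (suc-pred n) (n<1+n (pred n))))) (suc-pred n)))
      t-1∉ : f (offset t t-1) ≡ false
      t-1∉ rewrite offset-⊕ {t} (<⇒≤ t<n) (subst (pred n <_) (suc-pred n) (n<1+n (pred n)))
                 | <ᵇ-false (<⇒≤pred 2+c≤n) = refl
      cases : ⊥
      cases with d ≟ 0
      ... | yes d≡0 = nonadj t t<n t∈a (subst (λ z → a z ≡ true) (sym t+1≡s) s∈a)
        where
          t+1≡s : t ⊕ 1 ≡ s
          t+1≡s = trans (cong (_⊕ 1) (sym (offset≡0⇒≡ t<n x<n d≡0))) x+1≡s
      ... | no d≢0 = <⇒≢ z<s (begin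
          0                  ≡⟨ offset-self (<⇒≤ t<n) ⟨
          offset t t         ≡⟨ cong (offset t) (trans x+1≡s (sym t≡s)) ⟨
          offset t (x ⊕ 1)   ≡⟨ offset-suc-< t x d+1<n ⟩
          suc d              ∎)
        where
          open ≡-Reasoning
          t≡s : t ≡ s
          t≡s = trans (sym t-1+1≡t) (entry (⊕<n t _) t-1∉
            (trans (cong (f ∘ offset t) t-1+1≡t) (trans (cong f (offset-self (<⇒≤ t<n)))
              (f-true z<s (λ e → d≢0 (sym e))))))

  small-set-escapes-intervals : ∀ {c} → 2 + c ≤ n → (a : ℕ → Bool) → NonAdjacentℕ a →
    ∀ C → ∣ C ∣ < c → ¬ (∀ Z → C ⊆ Z → ∣ Z ∣ ≡ c → ∃ λ s → s < n × a s ≡ true × Z ≡ interval c s)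
  small-set-escapes-intervals {c} 2+c≤n a nonadj C ∣C∣<c cover
    with ⊆-extend C (<⇒≤ ∣C∣<c) (m+n≤o⇒n≤o 2 2+c≤n)
  ... | Z , C⊆Z , ∣Z∣≡c with cover Z C⊆Z ∣Z∣≡c
  ... | t , t<n , t∈a , refl with ∣p∣<∣q∣⇒∃∈q∖p {p = C} {q = interval c t} (subst (∣ C ∣ <_) (sym ∣Z∣≡c) ∣C∣<c)
  ... | x , x∈Z , x∉C =
    let d<c = <ᵇ-true⁻ (trans (sym (memℕ-interval c t (toℕ<n x))) (∈⇒memℕ x∈Z))
        (s , s<n , s∈a , P≡I) = cover (punctured c t (offset t (toℕ x)))
          (punctured-⊇ t<n (toℕ<n x) C⊆Z (∉⇒memℕ x∉C)) (∣punctured∣ (<⇒≤ t<n) d<c (m+n≤o⇒n≤o 1 2+c≤n))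
    in punctured-not-interval a nonadj 2+c≤n t<n t∈a (toℕ<n x) d<c s<n s∈a P≡I

  not-<ᵇ-rotate : ∀ {c r} → c < n → r < n → not (((c + r) % n) <ᵇ c) ≡ (r <ᵇ n ∸ c)
  not-<ᵇ-rotate {c} {r} c<n r<n with r <? n ∸ c
  ... | yes r<n∸c = begin
    not ((c + r) % n <ᵇ c)  ≡⟨ cong (λ z → not (z <ᵇ c)) (m<n⇒m%n≡m c+r<n) ⟩
    not (c + r <ᵇ c)        ≡⟨ cong not (<ᵇ-false (m≤m+n c r)) ⟩
    true                    ≡⟨ <ᵇ-true r<n∸c ⟨
    r <ᵇ n ∸ c              ∎
    where
      open ≡-Reasoning
      c+r<n : c + r < n
      c+r<n = subst (c + r <_) (m+[n∸m]≡n (<⇒≤ c<n)) (+-monoʳ-< c r<n∸c)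
  ... | no  r≮n∸c = begin
    not ((c + r) % n <ᵇ c)  ≡⟨ cong (λ z → not (z <ᵇ c)) c+r%n ⟩
    not (c + r ∸ n <ᵇ c)    ≡⟨ cong not (<ᵇ-true c+r∸n<c) ⟩
    false                   ≡⟨ <ᵇ-false (≮⇒≥ r≮n∸c) ⟨
    r <ᵇ n ∸ c              ∎
    where
      open ≡-Reasoning
      n≤c+r : n ≤ c + r
      n≤c+r = subst (_≤ c + r) (m+[n∸m]≡n (<⇒≤ c<n)) (+-monoʳ-≤ c (≮⇒≥ r≮n∸c))
      c+r∸n<c : c + r ∸ n < c
      c+r∸n<c = +-cancelʳ-< n (c + r ∸ n) c (subst (_< c + n) (sym (m∸n+n≡m n≤c+r)) (+-monoʳ-< c r<n))
      c+r%n : (c + r) % n ≡ c + r ∸ n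
      c+r%n = trans (cong (_% n) (sym (m∸n+n≡m n≤c+r))) (m<n⇒[m+n]%n≡m (<-trans c+r∸n<c c<n))

  ∁≡interval : ∀ {W c t} → c < n → t < n → ∁ W ≡ interval c t → W ≡ interval (n ∸ c) (t ⊕ c)
  ∁≡interval {W} {c} {t} c<n t<n ∁W≡I = memℕ-extensionality _ _ λ y y<n → begin
    memℕ W y                                  ≡⟨ not-involutive (memℕ W y) ⟨
    not (not (memℕ W y))                      ≡⟨ cong not (memℕ-∁ W y<n) ⟨
    not (memℕ (∁ W) y)                        ≡⟨ cong (λ X → not (memℕ X y)) ∁W≡I ⟩
    not (memℕ (interval c t) y)               ≡⟨ cong not (memℕ-interval c t y<n) ⟩
    not (offset t y <ᵇ c)                     ≡⟨ cong (λ z → not (z <ᵇ c)) (offset-via t<n y<n c<n) ⟩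
    not ((c + offset (t ⊕ c) y) % n <ᵇ c)     ≡⟨ not-<ᵇ-rotate c<n (offset<n (t ⊕ c) y) ⟩
    offset (t ⊕ c) y <ᵇ n ∸ c                 ≡⟨ memℕ-interval (n ∸ c) (t ⊕ c) y<n ⟨
    memℕ (interval (n ∸ c) (t ⊕ c)) y         ∎
    where open ≡-Reasoning

module Classification (m i : ℕ) (k+2≤n : 4 + i ≤ suc m) where
  n j k : ℕ
  n = suc m
  j = suc i
  k = suc j

  open Cyclic n
  open Ranks n
  open Intervals n

  memℕ-drop-add : ∀ (t : Fin n) (f : ℕ → Bool) {e y} → e < n → y < n →
    memℕ ((relative (toℕ t) f - t) ∪ ⁅ fromℕ< (⊕<n (toℕ t) e) ⁆) y ≡
    (f (offset (toℕ t) y) ∧ not (offset (toℕ t) y ≡ᵇ 0)) ∨ (offset (toℕ t) y ≡ᵇ e)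
  memℕ-drop-add t f {e} {y} e<n y<n = begin
    memℕ ((R - t) ∪ ⁅ t' ⁆) y                       ≡⟨ memℕ-∪ (R - t) ⁅ t' ⁆ y ⟩
    memℕ (R - t) y ∨ memℕ ⁅ t' ⁆ y                  ≡⟨ cong (_∨ memℕ ⁅ t' ⁆ y) (memℕ-remove R t y) ⟩
    (memℕ R y ∧ not (y ≡ᵇ toℕ t)) ∨ memℕ ⁅ t' ⁆ y   ≡⟨ cong₂ (λ a b → (a ∧ not (y ≡ᵇ toℕ t)) ∨ b)
                                                          (memℕ-relative (toℕ t) f y<n) (memℕ-⁅⁆ t' y) ⟩
    (f p ∧ not (y ≡ᵇ toℕ t)) ∨ (y ≡ᵇ toℕ t')        ≡⟨ cong₂ (λ a b → (f p ∧ not (y ≡ᵇ a)) ∨ (y ≡ᵇ b))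
                                                          (sym (⊕-identityʳ t<n)) (toℕ-fromℕ< (⊕<n (toℕ t) e)) ⟩
    (f p ∧ not (y ≡ᵇ toℕ t ⊕ 0)) ∨ (y ≡ᵇ toℕ t ⊕ e) ≡⟨ cong₂ (λ a b → (f p ∧ not a) ∨ b)
                                                          (≡ᵇ-⊕ t<n y<n z<s) (≡ᵇ-⊕ t<n y<n e<n) ⟩
    (f p ∧ not (p ≡ᵇ 0)) ∨ (p ≡ᵇ e)                 ∎
    where
      open ≡-Reasoning
      t<n : toℕ t < n
      t<n = toℕ<n t
      R : Subset n
      R = relative (toℕ t) f
      t' : Fin n
      t' = fromℕ< (⊕<n (toℕ t) e)
      p : ℕ
      p = offset (toℕ t) y

  -- The offset p of y from t is q + 1 for its offset q from t + 1, except that q = n - 1 gives p = 0.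
  shift-window : ∀ (t : Fin n) (f f' : ℕ → Bool) c → (∀ q → f' q ≡ (f (suc q) ∨ (suc q ≡ᵇ suc c))) → f' m ≡ false →
    ∀ {y} → y < n → f' (offset (toℕ t ⊕ 1) y) ≡
      (f (offset (toℕ t) y) ∧ not (offset (toℕ t) y ≡ᵇ 0)) ∨ (offset (toℕ t) y ≡ᵇ suc c)
  shift-window t f f' c shift f'-last {y} y<n = by-cases (suc q <? n)
    where
      q : ℕ
      q = offset (toℕ t ⊕ 1) y
      g : ℕ → Bool
      g p = (f p ∧ not (p ≡ᵇ 0)) ∨ (p ≡ᵇ suc c)
      p≡ : offset (toℕ t) y ≡ suc q % n
      p≡ = trans (cong (offset (toℕ t)) (sym (⊕-offset (<⇒≤ (⊕<n (toℕ t) 1)) y<n)))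
                 (offset-⊕-suc q (<⇒≤ (toℕ<n t)))
      by-cases : Dec (suc q < n) → f' q ≡ g (offset (toℕ t) y)
      by-cases (yes q+1<n) = trans (shift q) (sym (trans (cong g (trans p≡ (m<n⇒m%n≡m q+1<n)))
                                                      (cong (_∨ (suc q ≡ᵇ suc c)) (∧-identityʳ (f (suc q))))))
      by-cases (no  q+1≮n) = trans (cong f' (suc-injective q+1≡n)) (trans f'-last
                               (sym (trans (cong g (trans p≡ (trans (cong (_% n) q+1≡n) (n%n≡0 n))))
                                           (cong (_∨ false) (∧-zeroʳ (f 0))))))
        where
          q+1≡n : suc q ≡ n
          q+1≡n = ≤-antisym (offset<n (toℕ t ⊕ 1) y) (≮⇒≥ q+1≮n)

  relative-step : ∀ (t : Fin n) (f f' : ℕ → Bool) c → suc c < n → (∀ q → f' q ≡ (f (suc q) ∨ (suc q ≡ᵇ suc c))) →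
    f' m ≡ false → relative (toℕ (csuc t)) f' ≡ (relative (toℕ t) f - t) ∪ ⁅ fromℕ< (⊕<n (toℕ t) (suc c)) ⁆
  relative-step t f f' c 1+c<n shift f'-last = memℕ-extensionality _ _ λ y y<n →
    trans (memℕ-relative (toℕ (csuc t)) f' y<n)
      (trans (cong (λ z → f' (offset z y)) (toℕ-csuc t))
        (trans (shift-window t f f' c shift f'-last y<n) (sym (memℕ-drop-add t f 1+c<n y<n))))

  k≤m : k ≤ m
  k≤m = s≤s⁻¹ (m+n≤o⇒n≤o 1 k+2≤n)

  k<n : k < n
  k<n = s≤s k≤m

  k≤n : k ≤ n
  k≤n = <⇒≤ k<n

  2+j≤n : 2 + j ≤ n
  2+j≤n = m+n≤o⇒n≤o 1 k+2≤n

  necklace : Subset n → Fin n → Subset n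
  necklace A t = if memℕ A (toℕ t) then gapped j (toℕ t) else interval k (toℕ t)

  ∈-necklace : ∀ A t → t ∈ necklace A t
  ∈-necklace A t = memℕ⇒∈ (lemma (memℕ A (toℕ t)))
    where
      t≤n : toℕ t ≤ n
      t≤n = <⇒≤ (toℕ<n t)
      lemma : ∀ b → memℕ (if b then gapped j (toℕ t) else interval k (toℕ t)) (toℕ t) ≡ true
      lemma true  = trans (memℕ-relative (toℕ t) (gapAt j) (toℕ<n t)) (cong (gapAt j) (offset-self t≤n))
      lemma false = trans (memℕ-relative (toℕ t) (_<ᵇ k) (toℕ<n t)) (cong (_<ᵇ k) (offset-self t≤n))

  ∣necklace∣ : ∀ A t → ∣ necklace A t ∣ ≡ k
  ∣necklace∣ A t with memℕ A (toℕ t)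
  ... | true  = ∣gapped∣ 2+j≤n (<⇒≤ (toℕ<n t))
  ... | false = ∣interval∣ k≤n (<⇒≤ (toℕ<n t))

  necklace-step : ∀ A → IsNonAdjacent A → ∀ t →
    ∃ λ u → necklace A (csuc t) ≡ (necklace A t - t) ∪ ⁅ u ⁆
  necklace-step A nonadj t with memℕ A (toℕ t) in t∈A | memℕ A (toℕ (csuc t)) in t+1∈A
  ... | false | false = _ , relative-step t (_<ᵇ k) (_<ᵇ k) j k<n (λ q → <ᵇ-suc q j) (<ᵇ-false k≤m)
  ... | false | true  = _ , relative-step t (_<ᵇ k) (gapAt j) k k+2≤n (λ q → refl)
                              (gapAt-false (≤-trans (n≤1+n j) k≤m) (λ m≡k → <⇒≢ k+2≤n (cong suc (sym m≡k))))
  ... | true  | false = _ , relative-step t (gapAt j) (_<ᵇ k) i (<⇒≤ k<n) regroup (<ᵇ-false k≤m)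
    where
      regroup : ∀ q → (q <ᵇ k) ≡ (gapAt j (suc q) ∨ (suc q ≡ᵇ j))
      regroup q = begin
        (q <ᵇ suc j)                           ≡⟨ <ᵇ-suc q j ⟩
        (q <ᵇ j) ∨ (q ≡ᵇ j)                    ≡⟨ cong (_∨ (q ≡ᵇ j)) (<ᵇ-suc q i) ⟩
        ((q <ᵇ i) ∨ (q ≡ᵇ i)) ∨ (q ≡ᵇ j)       ≡⟨ ∨-assoc (q <ᵇ i) _ _ ⟩
        (q <ᵇ i) ∨ ((q ≡ᵇ i) ∨ (q ≡ᵇ j))       ≡⟨ cong ((q <ᵇ i) ∨_) (∨-comm (q ≡ᵇ i) _) ⟩
        (q <ᵇ i) ∨ ((q ≡ᵇ j) ∨ (q ≡ᵇ i))       ≡⟨ ∨-assoc (q <ᵇ i) _ _ ⟨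
        ((q <ᵇ i) ∨ (q ≡ᵇ j)) ∨ (q ≡ᵇ i)       ∎
        where open ≡-Reasoning
  ... | true  | true  = ⊥-elim (proj₂ (nonadj t (memℕ⇒∈ t∈A)) (memℕ⇒∈ t+1∈A))

  necklace-isGrassmann : ∀ A → IsNonAdjacent A → IsGrassmannNecklace n k (necklace A)
  necklace-isGrassmann A nonadj =
    ∣necklace∣ A , λ t → (λ _ → necklace-step A nonadj t) , (λ t∉ → ⊥-elim (t∉ (∈-necklace A t)))

  IsBasis : Subset n → Subset n → Set
  IsBasis A J = ∣ J ∣ ≡ k × (∀ t → GaleLe t (necklace A t) J)

  isBasis? : ∀ A J → Dec (IsBasis A J)
  isBasis? A J = (∣ J ∣ ≟ k) ×-dec all? (λ t → decidable _≤?_ (tRanks t (necklace A t)) (tRanks t J))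

  bases : Subset n → Family n
  bases A J = isYes (isBasis? A J)

  bases⇔ : ∀ A J → (bases A J ≡ true) ⇔ IsBasis A J
  bases⇔ A J = mk⇔ (toWitness ∘ from T-≡) (to T-≡ ∘ fromWitness)

  bases⁺ : ∀ A J → ∣ J ∣ ≡ k → (∀ t → t ∈ A → LeavesInterval k (toℕ t) J) → bases A J ≡ true
  bases⁺ A J ∣J∣≡k leaves = from (bases⇔ A J) (∣J∣≡k , Gale)
    where
      Gale : ∀ t → GaleLe t (necklace A t) J
      Gale t with memℕ A (toℕ t) in t∈A
      ... | true  = gapped-≤ₜ t {J = J} 2+j≤n ∣J∣≡k (leaves t (memℕ⇒∈ t∈A))
      ... | false = interval-≤ₜ t {J = J} k≤n ∣J∣≡k

  bases⁻ : ∀ A J t → bases A J ≡ true → t ∈ A → LeavesInterval k (toℕ t) J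
  bases⁻ A J t J∈B t∈A =
    gapped-≤ₜ⁻ t {J = J} 2+j≤n (subst (λ X → GaleLe t X J) necklace≡gapped (proj₂ (to (bases⇔ A J) J∈B) t))
    where
      necklace≡gapped : necklace A t ≡ gapped j (toℕ t)
      necklace≡gapped rewrite ∈⇒memℕ t∈A = refl

  non-basis-is-interval : ∀ A Z → ∣ Z ∣ ≡ k → bases A Z ≢ true →
    ∃ λ s → s < n × memℕ A s ≡ true × Z ≡ interval k s
  non-basis-is-interval A Z ∣Z∣≡k Z∉B with any? (λ s → (s ∈? A) ×-dec (Z ⊆? interval k (toℕ s)))
  ... | yes (s , s∈A , Z⊆I) = toℕ s , toℕ<n s , ∈⇒memℕ s∈A ,
          ⊆-antisym Z⊆I (⊆-∣∣-antisym Z⊆I (trans ∣Z∣≡k (sym (∣interval∣ k≤n (<⇒≤ (toℕ<n s))))))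
  ... | no  none = ⊥-elim (Z∉B (bases⁺ A Z ∣Z∣≡k leaves))
    where
      leaves : ∀ t → t ∈ A → LeavesInterval k (toℕ t) Z
      leaves t t∈A with ⊈⇒∃∈∖ (λ Z⊆I → none (t , t∈A , Z⊆I))
      ... | y , y∈Z , y∉I = toℕ y , toℕ<n y , ∈⇒memℕ y∈Z ,
              <ᵇ-false⁻ (trans (sym (memℕ-interval k (toℕ t) (toℕ<n y))) (∉⇒memℕ y∉I))

  NonAdjacent⇒ℕ : ∀ {A} → IsNonAdjacent A → NonAdjacentℕ (memℕ A)
  NonAdjacent⇒ℕ {A} nonadj t t<n t∈A t+1∈A =
    proj₂ (nonadj u (memℕ⇒∈-fromℕ< t<n t∈A)) (memℕ⇒∈ (trans (cong (memℕ A) toℕ-csuc-u) t+1∈A))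
    where
      u : Fin n
      u = fromℕ< t<n
      toℕ-csuc-u : toℕ (csuc u) ≡ t ⊕ 1
      toℕ-csuc-u = trans (toℕ-csuc u) (cong (_⊕ 1) (toℕ-fromℕ< t<n))

  circuits-large : ∀ {A} → IsNonAdjacent A → ∀ C → IsCircuit (bases A) C → k ≤ ∣ C ∣
  circuits-large {A} nonadj C (dependent , _) with k ≤? ∣ C ∣
  ... | yes k≤∣C∣ = k≤∣C∣
  ... | no  k≰∣C∣ = ⊥-elim (small-set-escapes-intervals k+2≤n (memℕ A) (NonAdjacent⇒ℕ nonadj) C (≰⇒> k≰∣C∣)
      λ Z C⊆Z ∣Z∣≡k → non-basis-is-interval A Z ∣Z∣≡k (λ Z∈B → dependent (Z , Z∈B , C⊆Z)))

  -- Complements of k-intervals are (n - k)-intervals, so the dual is handled by the same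
  -- covering argument, with the non-adjacent set A shifted back by n - k.
  dual-circuits-large : ∀ {A} → IsNonAdjacent A → ∀ C → IsCircuit (dual (bases A)) C → n ∸ k ≤ ∣ C ∣
  dual-circuits-large {A} nonadj C (dependent , _) with n ∸ k ≤? ∣ C ∣
  ... | yes ok = ok
  ... | no  n∸k≰∣C∣ = ⊥-elim (small-set-escapes-intervals 2+n∸k≤n shifted shifted-nonadj C (≰⇒> n∸k≰∣C∣) cover)
    where
      shifted : ℕ → Bool
      shifted s = memℕ A (s ⊕ (n ∸ k))
      shifted-nonadj : NonAdjacentℕ shifted
      shifted-nonadj t t<n e₁ e₂ = NonAdjacent⇒ℕ nonadj (t ⊕ (n ∸ k)) (⊕<n t _) e₁
        (trans (cong (memℕ A) (sym (⊕-comm-suc t (n ∸ k)))) e₂)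
      2+n∸k≤n : 2 + (n ∸ k) ≤ n
      2+n∸k≤n = subst (2 + (n ∸ k) ≤_) (m+[n∸m]≡n k≤n) (+-monoˡ-≤ (n ∸ k) (s≤s (s≤s z≤n)))
      cover : ∀ W → C ⊆ W → ∣ W ∣ ≡ n ∸ k → ∃ λ s → s < n × shifted s ≡ true × W ≡ interval (n ∸ k) s
      cover W C⊆W ∣W∣≡n∸k with non-basis-is-interval A (∁ W) ∣∁W∣≡k (λ ∁W∈B → dependent (W , ∁W∈B , C⊆W))
        where
          ∣∁W∣≡k : ∣ ∁ W ∣ ≡ k
          ∣∁W∣≡k = trans (∣∁p∣≡n∸∣p∣ W) (trans (cong (n ∸_) ∣W∣≡n∸k) (m∸[m∸n]≡n k≤n))
      ... | t , t<n , t∈A , ∁W≡I = t ⊕ k , ⊕<n t k ,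
        trans (cong (memℕ A) (⊕-⊕-complement t<n k≤n)) t∈A , ∁≡interval k<n t<n ∁W≡I

  sparsePavingPositroid : NonAdjacentSubset n → SparsePavingPositroid n k
  sparsePavingPositroid (A , nonadj) =
    bases A , (necklace A , necklace-isGrassmann A nonadj , bases⇔ A) ,
    circuits-large nonadj , dual-circuits-large nonadj

  interval-non-basis : ∀ A {a} → a < n → memℕ A a ≡ true → bases A (interval k a) ≢ true
  interval-non-basis A {a} a<n a∈A I∈B =
    stays-inside (bases⁻ A (interval k a) (fromℕ< a<n) I∈B (memℕ⇒∈-fromℕ< a<n a∈A))
    where
      stays-inside : ¬ LeavesInterval k (toℕ (fromℕ< a<n)) (interval k a)
      stays-inside (y , y<n , y∈I , k≤y) = <⇒≱ (<ᵇ-true⁻ (trans (sym (memℕ-interval k a y<n)) y∈I))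
                                             (subst (λ z → k ≤ offset z y) (toℕ-fromℕ< a<n) k≤y)

  -- For t ∈ A the point a (t ≠ a) lies at offset q from t; when q < k, the interval starting at
  -- a reaches offset k from t at its element a + (k - q).
  interval-basis : ∀ A {a} → a < n → memℕ A a ≡ false → bases A (interval k a) ≡ true
  interval-basis A {a} a<n a∉A = bases⁺ A (interval k a) (∣interval∣ k≤n (<⇒≤ a<n)) leaves
    where
      leaves : ∀ t → t ∈ A → LeavesInterval k (toℕ t) (interval k a)
      leaves t t∈A with k ≤? offset (toℕ t) a
      ... | yes k≤q = a , a<n , trans (memℕ-interval k a a<n) (cong (_<ᵇ k) (offset-self (<⇒≤ a<n))) , k≤q
      ... | no  k≰q = a ⊕ (k ∸ q) , ⊕<n a _ , y∈I , ≤-reflexive (sym offset-y≡k)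
        where
          q : ℕ
          q = offset (toℕ t) a
          q≤k : q ≤ k
          q≤k = <⇒≤ (≰⇒> k≰q)
          q≢0 : q ≢ 0
          q≢0 q≡0 = true≢false (trans (sym (∈⇒memℕ t∈A))
                      (trans (cong (memℕ A) (sym (offset≡0⇒≡ (toℕ<n t) a<n q≡0))) a∉A))
          k∸q<k : k ∸ q < k
          k∸q<k = ∸-monoʳ-< (n≢0⇒n>0 q≢0) q≤k
          y∈I : memℕ (interval k a) (a ⊕ (k ∸ q)) ≡ true
          y∈I = trans (memℕ-interval k a (⊕<n a _))
                  (trans (cong (_<ᵇ k) (offset-⊕ (<⇒≤ a<n) (<-trans k∸q<k k<n))) (<ᵇ-true k∸q<k))
          offset-y≡k : offset (toℕ t) (a ⊕ (k ∸ q)) ≡ k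
          offset-y≡k = trans (offset-⊕ˡ (toℕ t) a (k ∸ q))
                         (trans (cong (_% n) (m+[n∸m]≡n q≤k)) (m<n⇒m%n≡m k<n))

  memℕ-via-bases : ∀ A {a} → a < n → memℕ A a ≡ not (bases A (interval k a))
  memℕ-via-bases A a<n = ≡-not (interval-non-basis A a<n) (interval-basis A a<n)

  sparsePavingPositroid-injective : ∀ A A′ →
    proj₁ (sparsePavingPositroid A) ≈F proj₁ (sparsePavingPositroid A′) → proj₁ A ≡ proj₁ A′
  sparsePavingPositroid-injective (A , _) (A′ , _) same = memℕ-extensionality A A′ λ a a<n →
    trans (memℕ-via-bases A a<n) (trans (cong not (same (interval k a))) (sym (memℕ-via-bases A′ a<n)))

  module FromPositroid {B : Family n} {I : Fin n → Subset n} (I-necklace : IsGrassmannNecklace n k I)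
    (B⇔ : ∀ J → (B J ≡ true) ⇔ (∣ J ∣ ≡ k × (∀ t → GaleLe t (I t) J)))
    (circuits : ∀ C → IsCircuit B C → k ≤ ∣ C ∣)
    (dual-circuits : ∀ C → IsCircuit (dual B) C → n ∸ k ≤ ∣ C ∣) where

    -- Y ⊇ [t, t+j) is a basis by sparse paving of B, and Z ⊆ [t, t+k] is one by sparse paving of
    -- the dual; I t lies below both in the t-Gale order.
    entry-shape : ∀ t → I t ≡ interval k (toℕ t) ⊎ I t ≡ gapped j (toℕ t)
    entry-shape t =
      Gale-squeezed t {I = I t} {Y = Y} {Z = Z} 2+j≤n prefix ∣Y∣≡k (proj₂ Y-basis t) bound (proj₂ Z-basis t)
      where
        t≤n : toℕ t ≤ n
        t≤n = <⇒≤ (toℕ<n t)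
        X : Subset n
        X = interval j (toℕ t)
        Y-independent : Independent B X
        Y-independent = small-sets-independent B circuits X
          (subst (_< k) (sym (∣interval∣ (<⇒≤ (<-trans (n<1+n j) k<n)) t≤n)) (n<1+n j))
        Y : Subset n
        Y = proj₁ Y-independent
        Y-basis : ∣ Y ∣ ≡ k × (∀ t → GaleLe t (I t) Y)
        Y-basis = to (B⇔ Y) (proj₁ (proj₂ Y-independent))
        ∣Y∣≡k : ∣ Y ∣ ≡ k
        ∣Y∣≡k = proj₁ Y-basis
        prefix : ∀ r → r < j → memℕ Y (toℕ t ⊕ r) ≡ true
        prefix r r<j = ⊆⇒memℕ (proj₂ (proj₂ Y-independent)) (⊕<n (toℕ t) r)
          (trans (memℕ-interval j (toℕ t) (⊕<n (toℕ t) r))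
            (trans (cong (_<ᵇ j) (offset-⊕ t≤n (<-trans r<j (<-trans (n<1+n j) k<n)))) (<ᵇ-true r<j)))
        X′ : Subset n
        X′ = ∁ (interval (suc k) (toℕ t))
        ∣X′∣<n∸k : ∣ X′ ∣ < n ∸ k
        ∣X′∣<n∸k = subst (_< n ∸ k)
          (sym (trans (∣∁p∣≡n∸∣p∣ (interval (suc k) (toℕ t))) (cong (n ∸_) (∣interval∣ k<n t≤n))))
                     (∸-monoʳ-< (n<1+n k) k<n)
        W-independent : Independent (dual B) X′
        W-independent = small-sets-independent (dual B) dual-circuits X′ ∣X′∣<n∸k
        W : Subset n
        W = proj₁ W-independent
        Z : Subset n
        Z = ∁ W
        Z-basis : ∣ Z ∣ ≡ k × (∀ t → GaleLe t (I t) Z)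
        Z-basis = to (B⇔ Z) (proj₁ (proj₂ W-independent))
        bound : ∀ y → y < n → memℕ Z y ≡ true → offset (toℕ t) y ≤ k
        bound y y<n y∈Z with memℕ X′ y in y∈X′
        ... | true  = ⊥-elim (true≢false (trans (sym (⊆⇒memℕ (proj₂ (proj₂ W-independent)) y<n y∈X′))
                        (trans (sym (not-involutive (memℕ W y))) (cong not (trans (sym (memℕ-∁ W y<n)) y∈Z)))))
        ... | false = s≤s⁻¹ (<ᵇ-true⁻ (trans (sym (memℕ-interval (suc k) (toℕ t) y<n))
                        (trans (sym (not-involutive _)) (cong not (trans (sym (memℕ-∁ (interval (suc k) (toℕ t)) y<n)) y∈X′)))))

    A : Subset n
    A = tabulate (λ t → not (memℕ (I t) (toℕ t ⊕ j)))

    j-th∈interval : ∀ (t : Fin n) → memℕ (interval k (toℕ t)) (toℕ t ⊕ j) ≡ true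
    j-th∈interval t = trans (memℕ-interval k (toℕ t) (⊕<n (toℕ t) j))
      (trans (cong (_<ᵇ k) (offset-⊕ (<⇒≤ (toℕ<n t)) (<-trans (n<1+n j) k<n))) (<ᵇ-true (n<1+n j)))

    j-th∉gapped : ∀ (t : Fin n) → memℕ (gapped j (toℕ t)) (toℕ t ⊕ j) ≡ false
    j-th∉gapped t = trans (memℕ-relative-⊕ (gapAt j) (<⇒≤ (toℕ<n t)) (<-trans (n<1+n j) k<n)) (gapAt-gap j)

    necklace≡I : ∀ t → necklace A t ≡ I t
    necklace≡I t = from-shape (entry-shape t)
      where
        choose : Bool → Subset n
        choose b = if b then gapped j (toℕ t) else interval k (toℕ t)
        memℕ-A : memℕ A (toℕ t) ≡ not (memℕ (I t) (toℕ t ⊕ j))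
        memℕ-A = memℕ-tabulate (λ t → not (memℕ (I t) (toℕ t ⊕ j))) t
        from-shape : I t ≡ interval k (toℕ t) ⊎ I t ≡ gapped j (toℕ t) → necklace A t ≡ I t
        from-shape (inj₁ I≡interval) = trans (cong choose t∉A) (sym I≡interval)
          where
            t∉A : memℕ A (toℕ t) ≡ false
            t∉A = trans memℕ-A (cong not (trans (cong (λ X → memℕ X (toℕ t ⊕ j)) I≡interval) (j-th∈interval t)))
        from-shape (inj₂ I≡gapped) = trans (cong choose t∈A) (sym I≡gapped)
          where
            t∈A : memℕ A (toℕ t) ≡ true
            t∈A = trans memℕ-A (cong not (trans (cong (λ X → memℕ X (toℕ t ⊕ j)) I≡gapped) (j-th∉gapped t)))

    ∈A⇒gapped : ∀ t → t ∈ A → I t ≡ gapped j (toℕ t)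
    ∈A⇒gapped t t∈A = trans (sym (necklace≡I t)) necklace-gapped
      where
        necklace-gapped : necklace A t ≡ gapped j (toℕ t)
        necklace-gapped rewrite ∈⇒memℕ t∈A = refl

    -- t + k has offset k = j + 1 from t but offset j from t + 1: it is in I t, survives the
    -- necklace rule, and falls into the gap of I (t + 1).
    no-consecutive : ∀ t → t ∈ A → csuc t ∉ A
    no-consecutive t t∈A t+1∈A = y-escapes (proj₁ (proj₂ I-necklace t) t∈I)
      where
        t≤n : toℕ t ≤ n
        t≤n = <⇒≤ (toℕ<n t)
        t∈I : t ∈ I t
        t∈I = subst (t ∈_) (sym (∈A⇒gapped t t∈A))
                (memℕ⇒∈ (trans (memℕ-relative (toℕ t) (gapAt j) (toℕ<n t)) (cong (gapAt j) (offset-self t≤n))))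
        y : ℕ
        y = toℕ t ⊕ k
        y≢t : (y ≡ᵇ toℕ t) ≡ false
        y≢t = ≡ᵇ-false {y} {toℕ t} λ y≡t → <⇒≢ z<s (trans (sym (offset-self t≤n))
                (trans (cong (offset (toℕ t)) (sym y≡t)) (offset-⊕ t≤n k<n)))
        y∈I[t] : memℕ (I t) y ≡ true
        y∈I[t] = trans (cong (λ X → memℕ X y) (∈A⇒gapped t t∈A))
                   (trans (memℕ-relative-⊕ (gapAt j) t≤n k<n) (gapAt-suc j))
        y∈I[t+1] : ∀ u → I (csuc t) ≡ (I t - t) ∪ ⁅ u ⁆ → memℕ (I (csuc t)) y ≡ true
        y∈I[t+1] u I-step = trans (cong (λ X → memℕ X y) I-step)
          (trans (memℕ-∪ (I t - t) ⁅ u ⁆ y) (cong (_∨ memℕ ⁅ u ⁆ y)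
            (trans (memℕ-remove (I t) t y) (cong₂ (λ a b → a ∧ not b) y∈I[t] y≢t))))
        y∉I[t+1] : memℕ (I (csuc t)) y ≡ false
        y∉I[t+1] = begin
          memℕ (I (csuc t)) y                              ≡⟨ cong (λ X → memℕ X y) (∈A⇒gapped (csuc t) t+1∈A) ⟩
          memℕ (gapped j (toℕ (csuc t))) y                 ≡⟨ cong (λ z → memℕ (gapped j z) y) (toℕ-csuc t) ⟩
          memℕ (gapped j (toℕ t ⊕ 1)) (toℕ t ⊕ suc j)      ≡⟨ cong (memℕ (gapped j (toℕ t ⊕ 1))) (⊕-suc (toℕ t) j) ⟨
          memℕ (gapped j (toℕ t ⊕ 1)) ((toℕ t ⊕ 1) ⊕ j)    ≡⟨ memℕ-relative-⊕ (gapAt j) (<⇒≤ (⊕<n (toℕ t) 1)) j<n ⟩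
          gapAt j j                                        ≡⟨ gapAt-gap j ⟩
          false                                            ∎
          where
            open ≡-Reasoning
            j<n : j < n
            j<n = <-trans (n<1+n j) k<n
        y-escapes : ¬ (∃ λ u → I (csuc t) ≡ (I t - t) ∪ ⁅ u ⁆)
        y-escapes (u , I-step) = true≢false (trans (sym (y∈I[t+1] u I-step)) y∉I[t+1])

    A-nonadjacent : IsNonAdjacent A
    A-nonadjacent x x∈A =
      (λ x-1∈A → no-consecutive (cpred x) x-1∈A (subst (_∈ A) (sym (csuc-cpred x)) x∈A)) ,
      no-consecutive x x∈A

    bases≈B : bases A ≈F B
    bases≈B J = ≡-Bool (λ J∈B → from (B⇔ J) (toI (to (bases⇔ A J) J∈B)))
                       (λ J∈B → from (bases⇔ A J) (fromI (to (B⇔ J) J∈B)))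
      where
        toI : IsBasis A J → ∣ J ∣ ≡ k × (∀ t → GaleLe t (I t) J)
        toI (∣J∣≡k , Gale) = ∣J∣≡k , λ t → subst (λ X → GaleLe t X J) (necklace≡I t) (Gale t)
        fromI : ∣ J ∣ ≡ k × (∀ t → GaleLe t (I t) J) → IsBasis A J
        fromI (∣J∣≡k , Gale) = ∣J∣≡k , λ t → subst (λ X → GaleLe t X J) (sym (necklace≡I t)) (Gale t)

  sparsePavingPositroid-surjective : ∀ (M : SparsePavingPositroid n k) →
    ∃ λ A → proj₁ (sparsePavingPositroid A) ≈F proj₁ M
  sparsePavingPositroid-surjective (B , (I , I-necklace , B⇔) , circuits , dual-circuits) =
    (A , A-nonadjacent) , bases≈B
    where open FromPositroid I-necklace B⇔ circuits dual-circuits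

mainTheorem2 : (n k : ℕ) → 2 ≤ k → k ≤ n ∸ 2 →
    Σ (NonAdjacentSubset n → SparsePavingPositroid n k) λ φ →
    (∀ A A′ → proj₁ (φ A) ≈F proj₁ (φ A′) → proj₁ A ≡ proj₁ A′) ×
    (∀ (M : SparsePavingPositroid n k) → ∃ λ A → proj₁ (φ A) ≈F proj₁ M)
mainTheorem2 (suc (suc m)) (suc (suc i)) (s≤s (s≤s z≤n)) k≤n∸2 =
  sparsePavingPositroid , sparsePavingPositroid-injective , sparsePavingPositroid-surjective
  where open Classification (suc m) i (s≤s (s≤s k≤n∸2))
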